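{- (Subject conversion.) Let $g:\mathbb N\to\mathbb N$ satisfy $h<g(h)$ for all $h$. For every environment $C$ and terms $U_1,U_2,T_1,T_2$: if $C\vdash_g U_1:T_1$, $C\vdash_g U_2:T_2$ and $C\vdash U_1\Leftrightarrow U_2$, then $C\vdash T_1\Leftrightarrow T_2$ and $C\vdash_g U_1:T_2$.
   Context: Terms of $\lambda\delta$: $T ::= \ast h \mid x \mid \lambda x{:}W.\,T \mid \delta x{=}V.\,T \mid \mathrm{appl}(V,T) \mid \mathrm{cast}(W,T)$ ($h\in\mathbb N$, $x$ a variable); $\ast h$ is a sort, $\lambda x{:}W.T$ abstraction over type $W$, $\delta x{=}V.T$ the abbreviation "let $x=V$ in $T$", $\mathrm{appl}(V,T)$ application of $T$ to argument $V$, $\mathrm{cast}(W,T)$ $T$ annotated with type $W$. In $\lambda x{:}W.T$, $\delta x{=}V.T$, $x$ is bound in $T$ only; $\mathrm{FV}(T)$ free variables; terms up to renaming of bound variables with bound and free names disjoint. Environments: $E ::= \ast h \mid \lambda x{:}W.E \mid \delta x{=}V.E \mid \mathrm{appl}(V,E)\mid\mathrm{cast}(W,E)$. $E.\lambda x{:}W$ (resp. $E.\delta x{=}V$) is $E$ with its terminal sort $\ast h$ replaced by $\lambda x{:}W.\ast h$ (resp. $\delta x{=}V.\ast h$). $E=C_1\cdot\beta\cdot C_2$, for an item $\beta$ of the form $\lambda x{:}W$ or $\delta x{=}V$, means $E$ is obtained from the environment $C_1$ by replacing its terminal sort with $\beta.C_2$ for some environment $C_2$. Strict substitution: $T[x:=^+W]\,T'$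 iff $x\notin\mathrm{FV}(W)$, $x\in\mathrm{FV}(T)$ and $T'$ arises from $T$ by replacing a nonempty set of free occurrences of $x$ by $W$. Environment-free parallel reduction $\to_0$: least relation closed under (refl) $T\to_0T$; (compatibility) if $A_1\to_0A_2$, $T_1\to_0T_2$ then $\lambda x{:}A_1.T_1\to_0\lambda x{:}A_2.T_2$, $\delta x{=}A_1.T_1\to_0\delta x{=}A_2.T_2$, $\mathrm{appl}(A_1,T_1)\to_0\mathrm{appl}(A_2,T_2)$, $\mathrm{cast}(A_1,T_1)\to_0\mathrm{cast}(A_2,T_2)$; ($\beta$) if $V_1\to_0V_2$, $T_1\to_0T_2$ then $\mathrm{appl}(V_1,\lambda x{:}W.T_1)\to_0\delta x{=}V_2.T_2$; ($\delta$) if $V_1\to_0V_2$, $T_1\to_0T_2$, $T_2[x:=^+V_2]T$ then $\delta x{=}V_1.T_1\to_0\delta x{=}V_2.T$; ($\zeta$) if $T_1\to_0T_2$, $x\notin\mathrm{FV}(T_1)$ then $\delta x{=}V.T_1\to_0T_2$; ($\tau$) if $T_1\to_0T_2$ then $\mathrm{cast}(W,T_1)\to_0T_2$; ($\upsilon$) if $V_1\to_0V_3$, $V_2\to_0V_4$, $T_1\to_0T_2$ then $\mathrm{appl}(V_1,\delta x{=}V_2.T_1)\to_0\delta x{=}V_4.\mathrm{appl}(V_3,T_2)$. $E\vdash T_1\to T_2$ iff $T_1\to_0T_2$, or $E=C_1\cdot\delta x{=}V\cdot C_2$, $T_1\to_0T'$, $T'[x:=^+V]T_2$. Conversion $E\vdash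 T_1\Leftrightarrow T_2$ is its symmetric and transitive closure. Native type assignment $E\vdash_g T:U$ is the least relation closed under: (sort) $E\vdash_g\ast h:\ast g(h)$; (def) if $E=C_1\cdot\delta x{=}V\cdot C_2$ and $C_1\vdash_g V:W$ then $E\vdash_g x:W$; (decl) if $E=C_1\cdot\lambda x{:}W\cdot C_2$ and $C_1\vdash_g W:V$ then $E\vdash_g x:W$; (abbr) if $E\vdash_g V:W$ and $E.\delta x{=}V\vdash_g T:U$ then $E\vdash_g\delta x{=}V.T:\delta x{=}V.U$; (abst) if $E\vdash_g W:V$ and $E.\lambda x{:}W\vdash_g T:U$ then $E\vdash_g\lambda x{:}W.T:\lambda x{:}W.U$; (appl) if $E\vdash_g V:W$ and $E\vdash_g T:\lambda x{:}W.U$ then $E\vdash_g\mathrm{appl}(V,T):\mathrm{appl}(V,\lambda x{:}W.U)$; (cast) if $E\vdash_g T:W$ and $E\vdash_g W:V$ then $E\vdash_g\mathrm{cast}(W,T):\mathrm{cast}(V,W)$; (conv) if $E\vdash_g U_2:W$, $E\vdash_g T:U_1$ and $E\vdash U_1\Leftrightarrow U_2$ then $E\vdash_g T:U_2$. -}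

module Defs where

open import Data.Nat using (ℕ; zero; suc; _+_; _<ᵇ_)
open import Data.Bool using (Bool; true; false; _∨_; if_then_else_)
open import Data.Product using (Σ; ∃; _×_; _,_)
open import Data.Sum using (_⊎_)
open import Relation.Nullary using (¬_)
open import Relation.Binary.PropositionalEquality using (_≡_)

-- Terms of λδ, with de Bruijn indices for variables.
--   sort h      = ∗h
--   var i       = variable (de Bruijn index i)
--   lam W T     = λx:W.T      (x bound in T only)
--   abbr V T    = δx=V.T      (x bound in T only)
--   appl V T    = appl(V,T)
--   cast W T    = cast(W,T)

data Term : Set where
  sort : ℕ → Term
  var  : ℕ → Term
  lam  : Term → Term → Term
  abbr : Term → Term → Term
  appl : Term → Term → Term
  cast : Term → Term → Term

lift : ℕ → ℕ → Term → Term
lift d k (sort h)   = sort h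
lift d k (var j)    = if j <ᵇ d then var j else var (j + k)
lift d k (lam W T)  = lam  (lift d k W) (lift (suc d) k T)
lift d k (abbr V T) = abbr (lift d k V) (lift (suc d) k T)
lift d k (appl V T) = appl (lift d k V) (lift d k T)
lift d k (cast W T) = cast (lift d k W) (lift d k T)

data _∈FV_ : ℕ → Term → Set where
  fv-var   : ∀ {i} → i ∈FV var i
  fv-lamˡ  : ∀ {i W T} → i ∈FV W → i ∈FV lam W T
  fv-lamʳ  : ∀ {i W T} → suc i ∈FV T → i ∈FV lam W T
  fv-abbrˡ : ∀ {i V T} → i ∈FV V → i ∈FV abbr V T
  fv-abbrʳ : ∀ {i V T} → suc i ∈FV T → i ∈FV abbr V T
  fv-applˡ : ∀ {i V T} → i ∈FV V → i ∈FV appl V T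
  fv-applʳ : ∀ {i V T} → i ∈FV T → i ∈FV appl V T
  fv-castˡ : ∀ {i W T} → i ∈FV W → i ∈FV cast W T
  fv-castʳ : ∀ {i W T} → i ∈FV T → i ∈FV cast W T

-- Rep b i W T T' : T' arises from T by replacing some set of free
-- occurrences of i by W (W lifted when going under binders);
-- b = true iff the set of replaced occurrences is nonempty.
data Rep : Bool → ℕ → Term → Term → Term → Set where
  rep-sort : ∀ {i W h} → Rep false i W (sort h) (sort h)
  rep-keep : ∀ {i W j} → Rep false i W (var j) (var j)
  rep-hit  : ∀ {i W} → Rep true i W (var i) W
  rep-lam  : ∀ {b c i W A A' T T'} → Rep b i W A A' →
             Rep c (suc i) (lift 0 1 W) T T' → Rep (b ∨ c) i W (lam A T) (lam A' T')
  rep-abbr : ∀ {b c i W A A' T T'} → Rep b i W A A' →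
             Rep c (suc i) (lift 0 1 W) T T' → Rep (b ∨ c) i W (abbr A T) (abbr A' T')
  rep-appl : ∀ {b c i W A A' T T'} → Rep b i W A A' →
             Rep c i W T T' → Rep (b ∨ c) i W (appl A T) (appl A' T')
  rep-cast : ∀ {b c i W A A' T T'} → Rep b i W A A' →
             Rep c i W T T' → Rep (b ∨ c) i W (cast A T) (cast A' T')

StrictSubst : ℕ → Term → Term → Term → Set
StrictSubst i W T T' = (¬ (i ∈FV W)) × (i ∈FV T) × Rep true i W T T'

infix 4 _→0_
data _→0_ : Term → Term → Set where
  r-refl : ∀ {T} → T →0 T
  r-lam  : ∀ {A₁ A₂ T₁ T₂} → A₁ →0 A₂ → T₁ →0 T₂ → lam A₁ T₁ →0 lam A₂ T₂
  r-abbr : ∀ {A₁ A₂ T₁ T₂} → A₁ →0 A₂ → T₁ →0 T₂ → abbr A₁ T₁ →0 abbr A₂ T₂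
  r-appl : ∀ {A₁ A₂ T₁ T₂} → A₁ →0 A₂ → T₁ →0 T₂ → appl A₁ T₁ →0 appl A₂ T₂
  r-cast : ∀ {A₁ A₂ T₁ T₂} → A₁ →0 A₂ → T₁ →0 T₂ → cast A₁ T₁ →0 cast A₂ T₂
  r-β    : ∀ {V₁ V₂ W T₁ T₂} → V₁ →0 V₂ → T₁ →0 T₂ →
           appl V₁ (lam W T₁) →0 abbr V₂ T₂
  r-δ    : ∀ {V₁ V₂ T₁ T₂ T} → V₁ →0 V₂ → T₁ →0 T₂ →
           StrictSubst 0 (lift 0 1 V₂) T₂ T →
           abbr V₁ T₁ →0 abbr V₂ T
  -- x ∉ FV(T₁); the reduct T₂' of T₁ is read outside the scope of x,
  -- i.e. T₂' = lift 0 1 T₂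
  r-ζ    : ∀ {V T₁ T₂' T₂} → T₁ →0 T₂' → ¬ (0 ∈FV T₁) →
           T₂' ≡ lift 0 1 T₂ → abbr V T₁ →0 T₂
  r-τ    : ∀ {W T₁ T₂} → T₁ →0 T₂ → cast W T₁ →0 T₂
  r-υ    : ∀ {V₁ V₂ V₃ V₄ T₁ T₂} → V₁ →0 V₃ → V₂ →0 V₄ → T₁ →0 T₂ →
           appl V₁ (abbr V₂ T₁) →0 abbr V₄ (appl (lift 0 1 V₃) T₂)

-- Environments (outermost item first, ending with a sort)

data Env : Set where
  sortE : ℕ → Env
  lamE  : Term → Env → Env
  abbrE : Term → Env → Env
  applE : Term → Env → Env
  castE : Term → Env → Env

graft : Env → Env → Env
graft (sortE h)   C₂ = C₂
graft (lamE W C)  C₂ = lamE W (graft C C₂)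
graft (abbrE V C) C₂ = abbrE V (graft C C₂)
graft (applE V C) C₂ = applE V (graft C C₂)
graft (castE W C) C₂ = castE W (graft C C₂)

terminal : Env → ℕ
terminal (sortE h)   = h
terminal (lamE _ C)  = terminal C
terminal (abbrE _ C) = terminal C
terminal (applE _ C) = terminal C
terminal (castE _ C) = terminal C

_∙λ_ : Env → Term → Env
E ∙λ W = graft E (lamE W (sortE (terminal E)))

_∙δ_ : Env → Term → Env
E ∙δ V = graft E (abbrE V (sortE (terminal E)))

binders : Env → ℕ
binders (sortE _)   = 0
binders (lamE _ C)  = suc (binders C)
binders (abbrE _ C) = suc (binders C)
binders (applE _ C) = binders C
binders (castE _ C) = binders C

-- Reduction and conversion in an environment.
-- If E = C₁·δx=V·C₂, then x has index (binders C₂) in E, and V, which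
-- lives in C₁, reads as lift 0 (suc (binders C₂)) V in E.

data _⊢_⟶_ (E : Env) : Term → Term → Set where
  red-0 : ∀ {T₁ T₂} → T₁ →0 T₂ → E ⊢ T₁ ⟶ T₂
  red-δ : ∀ {T₁ T₂ T'} (C₁ C₂ : Env) (V : Term) →
          E ≡ graft C₁ (abbrE V C₂) → T₁ →0 T' →
          StrictSubst (binders C₂) (lift 0 (suc (binders C₂)) V) T' T₂ →
          E ⊢ T₁ ⟶ T₂

data _⊢_⇔_ (E : Env) : Term → Term → Set where
  conv-step  : ∀ {T₁ T₂} → E ⊢ T₁ ⟶ T₂ → E ⊢ T₁ ⇔ T₂
  conv-sym   : ∀ {T₁ T₂} → E ⊢ T₁ ⇔ T₂ → E ⊢ T₂ ⇔ T₁
  conv-trans : ∀ {T₁ T₂ T₃} → E ⊢ T₁ ⇔ T₂ → E ⊢ T₂ ⇔ T₃ → E ⊢ T₁ ⇔ T₃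

data _⊢[_]_∶_ : Env → (ℕ → ℕ) → Term → Term → Set where
  ty-sort : ∀ {E g h} → E ⊢[ g ] sort h ∶ sort (g h)
  ty-def  : ∀ {E g} (C₁ C₂ : Env) {V W : Term} →
            E ≡ graft C₁ (abbrE V C₂) → C₁ ⊢[ g ] V ∶ W →
            E ⊢[ g ] var (binders C₂) ∶ lift 0 (suc (binders C₂)) W
  ty-decl : ∀ {E g} (C₁ C₂ : Env) {W V : Term} →
            E ≡ graft C₁ (lamE W C₂) → C₁ ⊢[ g ] W ∶ V →
            E ⊢[ g ] var (binders C₂) ∶ lift 0 (suc (binders C₂)) W
  ty-abbr : ∀ {E g V W T U} → E ⊢[ g ] V ∶ W → (E ∙δ V) ⊢[ g ] T ∶ U →
            E ⊢[ g ] abbr V T ∶ abbr V U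
  ty-abst : ∀ {E g W V T U} → E ⊢[ g ] W ∶ V → (E ∙λ W) ⊢[ g ] T ∶ U →
            E ⊢[ g ] lam W T ∶ lam W U
  ty-appl : ∀ {E g V W T U} → E ⊢[ g ] V ∶ W → E ⊢[ g ] T ∶ lam W U →
            E ⊢[ g ] appl V T ∶ appl V (lam W U)
  ty-cast : ∀ {E g T W V} → E ⊢[ g ] T ∶ W → E ⊢[ g ] W ∶ V →
            E ⊢[ g ] cast W T ∶ cast V W
  ty-conv : ∀ {E g T U₁ U₂ W} → E ⊢[ g ] U₂ ∶ W → E ⊢[ g ] T ∶ U₁ →
            E ⊢ U₁ ⇔ U₂ → E ⊢[ g ] T ∶ U₂

-- Conversion in an environment E is characterised through the parallel reduction ⇛, which
-- contracts β-, υ- and τ-redexes and whole abbreviations (δx=V.T ⇛ T[x:=V]) and has the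
-- diamond property: E ⊢ A ⇔ B iff the terms obtained from A and B by unfolding every
-- abbreviation of E are ⇛-convertible. Hence if U₁ ⇔ U₂, their unfoldings reduce to a common
-- term U. Unfolding and ⇛ preserve types, so U has both types T₁ and T₂, which are therefore
-- convertible since types are unique up to conversion. Finally U₁ : T₂ by the conversion
-- rule, T₂ being typable by validity.

{-# OPTIONS --safe #-}
module Submission where

open import Defs
open import Data.Bool using (Bool; true; false; _∨_)
open import Data.Bool.Properties using (∨-conicalˡ; ∨-conicalʳ)
open import Data.Empty using (⊥-elim)
open import Data.List using (List; []; _∷_)
open import Data.Nat using (ℕ; zero; suc; _+_; _<_; _<ᵇ_)
open import Data.Nat.Properties using (+-suc; +-identityʳ; suc-injective; m≢1+n+m; _≟_)
open import Data.Product using (∃; ∃₂; _×_; _,_; proj₁; proj₂)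
open import Data.Sum using (_⊎_; inj₁; inj₂)
open import Function using (_∘_; id)
open import Relation.Binary.Construct.Closure.Equivalence using (EqClosure; gmap; symmetric)
open import Relation.Binary.Construct.Closure.Equivalence.Properties using (a—↠b⇒a↔b)
open import Relation.Binary.Construct.Closure.ReflexiveTransitive as Star using (Star; ε; _◅_; _◅◅_)
open import Relation.Binary.Construct.Closure.Symmetric using (fwd; bwd)
open import Relation.Binary.Rewriting using (Confluent)
open import Relation.Nullary using (¬_; yes; no)
open import Relation.Binary.PropositionalEquality
  using (_≡_; _≢_; _≗_; refl; sym; trans; cong; cong₂; subst; subst₂; module ≡-Reasoning)

Ren : Set
Ren = ℕ → ℕ

Sub : Set
Sub = ℕ → Term

private
  variable
    b : Bool
    d i k n : ℕ
    ρ ρ′ : Ren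
    σ σ′ : Sub
    E : Env
    A A′ B B′ C T T′ T₁ T₂ U U′ U₁ U₂ V V′ V₁ V₂ W W′ X : Term

⇑ʳ : Ren → Ren
⇑ʳ ρ zero    = zero
⇑ʳ ρ (suc j) = suc (ρ j)

ren : Ren → Term → Term
ren ρ (sort h)   = sort h
ren ρ (var j)    = var (ρ j)
ren ρ (lam W T)  = lam  (ren ρ W) (ren (⇑ʳ ρ) T)
ren ρ (abbr V T) = abbr (ren ρ V) (ren (⇑ʳ ρ) T)
ren ρ (appl V T) = appl (ren ρ V) (ren ρ T)
ren ρ (cast W T) = cast (ren ρ W) (ren ρ T)

wk : Term → Term
wk = ren suc

infixr 5 _∷ₛ_
_∷ₛ_ : Term → Sub → Sub
(V ∷ₛ σ) zero    = V
(V ∷ₛ σ) (suc j) = σ j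

⇑ : Sub → Sub
⇑ σ = var zero ∷ₛ wk ∘ σ

sub : Sub → Term → Term
sub σ (sort h)   = sort h
sub σ (var j)    = σ j
sub σ (lam W T)  = lam  (sub σ W) (sub (⇑ σ) T)
sub σ (abbr V T) = abbr (sub σ V) (sub (⇑ σ) T)
sub σ (appl V T) = appl (sub σ V) (sub σ T)
sub σ (cast W T) = cast (sub σ W) (sub σ T)

_[_] : Term → Term → Term
T [ V ] = sub (V ∷ₛ var) T

⇑ʳ-cong : ρ ≗ ρ′ → ⇑ʳ ρ ≗ ⇑ʳ ρ′
⇑ʳ-cong e zero    = refl
⇑ʳ-cong e (suc j) = cong suc (e j)

ren-cong : ρ ≗ ρ′ → ∀ T → ren ρ T ≡ ren ρ′ T
ren-cong e (sort h)   = refl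
ren-cong e (var j)    = cong var (e j)
ren-cong e (lam W T)  = cong₂ lam  (ren-cong e W) (ren-cong (⇑ʳ-cong e) T)
ren-cong e (abbr V T) = cong₂ abbr (ren-cong e V) (ren-cong (⇑ʳ-cong e) T)
ren-cong e (appl V T) = cong₂ appl (ren-cong e V) (ren-cong e T)
ren-cong e (cast W T) = cong₂ cast (ren-cong e W) (ren-cong e T)

⇑ʳ-id : ρ ≗ id → ⇑ʳ ρ ≗ id
⇑ʳ-id e zero    = refl
⇑ʳ-id e (suc j) = cong suc (e j)

ren-id : ρ ≗ id → ∀ T → ren ρ T ≡ T
ren-id e (sort h)   = refl
ren-id e (var j)    = cong var (e j)
ren-id e (lam W T)  = cong₂ lam  (ren-id e W) (ren-id (⇑ʳ-id e) T)
ren-id e (abbr V T) = cong₂ abbr (ren-id e V) (ren-id (⇑ʳ-id e) T)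
ren-id e (appl V T) = cong₂ appl (ren-id e V) (ren-id e T)
ren-id e (cast W T) = cong₂ cast (ren-id e W) (ren-id e T)

⇑ʳ-∘ : ∀ ρ ρ′ → ⇑ʳ ρ ∘ ⇑ʳ ρ′ ≗ ⇑ʳ (ρ ∘ ρ′)
⇑ʳ-∘ ρ ρ′ zero    = refl
⇑ʳ-∘ ρ ρ′ (suc j) = refl

ren-ren : ∀ ρ ρ′ T → ren ρ (ren ρ′ T) ≡ ren (ρ ∘ ρ′) T
ren-ren ρ ρ′ (sort h)   = refl
ren-ren ρ ρ′ (var j)    = refl
ren-ren ρ ρ′ (lam W T)  =
  cong₂ lam  (ren-ren ρ ρ′ W) (trans (ren-ren (⇑ʳ ρ) (⇑ʳ ρ′) T) (ren-cong (⇑ʳ-∘ ρ ρ′) T))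
ren-ren ρ ρ′ (abbr V T) =
  cong₂ abbr (ren-ren ρ ρ′ V) (trans (ren-ren (⇑ʳ ρ) (⇑ʳ ρ′) T) (ren-cong (⇑ʳ-∘ ρ ρ′) T))
ren-ren ρ ρ′ (appl V T) = cong₂ appl (ren-ren ρ ρ′ V) (ren-ren ρ ρ′ T)
ren-ren ρ ρ′ (cast W T) = cong₂ cast (ren-ren ρ ρ′ W) (ren-ren ρ ρ′ T)

wk-⇑ʳ : ∀ ρ V → ren (⇑ʳ ρ) (wk V) ≡ wk (ren ρ V)
wk-⇑ʳ ρ V = trans (ren-ren (⇑ʳ ρ) suc V) (sym (ren-ren suc ρ V))

ren-⇑ʳ-wk-cong : ∀ ρ A → ren ρ A ≡ B → ren (⇑ʳ ρ) (wk A) ≡ wk B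
ren-⇑ʳ-wk-cong ρ A e = trans (wk-⇑ʳ ρ A) (cong wk e)

⇑-cong : σ ≗ σ′ → ⇑ σ ≗ ⇑ σ′
⇑-cong e zero    = refl
⇑-cong e (suc j) = cong wk (e j)

sub-cong : σ ≗ σ′ → ∀ T → sub σ T ≡ sub σ′ T
sub-cong e (sort h)   = refl
sub-cong e (var j)    = e j
sub-cong e (lam W T)  = cong₂ lam  (sub-cong e W) (sub-cong (⇑-cong e) T)
sub-cong e (abbr V T) = cong₂ abbr (sub-cong e V) (sub-cong (⇑-cong e) T)
sub-cong e (appl V T) = cong₂ appl (sub-cong e V) (sub-cong e T)
sub-cong e (cast W T) = cong₂ cast (sub-cong e W) (sub-cong e T)

⇑-id : σ ≗ var → ⇑ σ ≗ var
⇑-id e zero    = refl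
⇑-id e (suc j) = cong wk (e j)

sub-id : σ ≗ var → ∀ T → sub σ T ≡ T
sub-id e (sort h)   = refl
sub-id e (var j)    = e j
sub-id e (lam W T)  = cong₂ lam  (sub-id e W) (sub-id (⇑-id e) T)
sub-id e (abbr V T) = cong₂ abbr (sub-id e V) (sub-id (⇑-id e) T)
sub-id e (appl V T) = cong₂ appl (sub-id e V) (sub-id e T)
sub-id e (cast W T) = cong₂ cast (sub-id e W) (sub-id e T)

⇑-∘-⇑ʳ : ∀ σ ρ → ⇑ σ ∘ ⇑ʳ ρ ≗ ⇑ (σ ∘ ρ)
⇑-∘-⇑ʳ σ ρ zero    = refl
⇑-∘-⇑ʳ σ ρ (suc j) = refl

sub-ren : ∀ σ ρ T → sub σ (ren ρ T) ≡ sub (σ ∘ ρ) T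
sub-ren σ ρ (sort h)   = refl
sub-ren σ ρ (var j)    = refl
sub-ren σ ρ (lam W T)  = cong₂ lam  (sub-ren σ ρ W) (trans (sub-ren (⇑ σ) (⇑ʳ ρ) T) (sub-cong (⇑-∘-⇑ʳ σ ρ) T))
sub-ren σ ρ (abbr V T) = cong₂ abbr (sub-ren σ ρ V) (trans (sub-ren (⇑ σ) (⇑ʳ ρ) T) (sub-cong (⇑-∘-⇑ʳ σ ρ) T))
sub-ren σ ρ (appl V T) = cong₂ appl (sub-ren σ ρ V) (sub-ren σ ρ T)
sub-ren σ ρ (cast W T) = cong₂ cast (sub-ren σ ρ W) (sub-ren σ ρ T)

ren-∘-⇑ : ∀ ρ σ → ren (⇑ʳ ρ) ∘ ⇑ σ ≗ ⇑ (ren ρ ∘ σ)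
ren-∘-⇑ ρ σ zero    = refl
ren-∘-⇑ ρ σ (suc j) = wk-⇑ʳ ρ (σ j)

ren-sub : ∀ ρ σ T → ren ρ (sub σ T) ≡ sub (ren ρ ∘ σ) T
ren-sub ρ σ (sort h)   = refl
ren-sub ρ σ (var j)    = refl
ren-sub ρ σ (lam W T)  = cong₂ lam  (ren-sub ρ σ W) (trans (ren-sub (⇑ʳ ρ) (⇑ σ) T) (sub-cong (ren-∘-⇑ ρ σ) T))
ren-sub ρ σ (abbr V T) = cong₂ abbr (ren-sub ρ σ V) (trans (ren-sub (⇑ʳ ρ) (⇑ σ) T) (sub-cong (ren-∘-⇑ ρ σ) T))
ren-sub ρ σ (appl V T) = cong₂ appl (ren-sub ρ σ V) (ren-sub ρ σ T)
ren-sub ρ σ (cast W T) = cong₂ cast (ren-sub ρ σ W) (ren-sub ρ σ T)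

sub-⇑-wk : ∀ σ A → sub (⇑ σ) (wk A) ≡ wk (sub σ A)
sub-⇑-wk σ A = trans (sub-ren (⇑ σ) suc A) (sym (ren-sub suc σ A))

sub-⇑-wk-cong : ∀ σ A → sub σ A ≡ B → sub (⇑ σ) (wk A) ≡ wk B
sub-⇑-wk-cong σ A e = trans (sub-⇑-wk σ A) (cong wk e)

sub-∘-⇑ : ∀ σ τ → sub (⇑ σ) ∘ ⇑ τ ≗ ⇑ (sub σ ∘ τ)
sub-∘-⇑ σ τ zero    = refl
sub-∘-⇑ σ τ (suc j) = sub-⇑-wk σ (τ j)

sub-sub : ∀ σ τ T → sub σ (sub τ T) ≡ sub (sub σ ∘ τ) T
sub-sub σ τ (sort h)   = refl
sub-sub σ τ (var j)    = refl
sub-sub σ τ (lam W T)  = cong₂ lam  (sub-sub σ τ W) (trans (sub-sub (⇑ σ) (⇑ τ) T) (sub-cong (sub-∘-⇑ σ τ) T))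
sub-sub σ τ (abbr V T) = cong₂ abbr (sub-sub σ τ V) (trans (sub-sub (⇑ σ) (⇑ τ) T) (sub-cong (sub-∘-⇑ σ τ) T))
sub-sub σ τ (appl V T) = cong₂ appl (sub-sub σ τ V) (sub-sub σ τ T)
sub-sub σ τ (cast W T) = cong₂ cast (sub-sub σ τ W) (sub-sub σ τ T)

ren≡sub : ∀ ρ T → ren ρ T ≡ sub (var ∘ ρ) T
ren≡sub ρ T = trans (sym (sub-id (λ _ → refl) (ren ρ T))) (sub-ren var ρ T)

wk-[] : ∀ V T → (wk T) [ V ] ≡ T
wk-[] V T = trans (sub-ren (V ∷ₛ var) suc T) (sub-id (λ _ → refl) T)

⇑-[] : ∀ σ V U → (sub (⇑ σ) U) [ V ] ≡ sub (V ∷ₛ σ) U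
⇑-[] σ V U = trans (sub-sub (V ∷ₛ var) (⇑ σ) U) (sub-cong pointwise U)
  where
  pointwise : sub (V ∷ₛ var) ∘ ⇑ σ ≗ V ∷ₛ σ
  pointwise zero    = refl
  pointwise (suc j) = wk-[] V (σ j)

sub-[] : ∀ σ T V → sub σ (T [ V ]) ≡ (sub (⇑ σ) T) [ sub σ V ]
sub-[] σ T V = begin
  sub σ (T [ V ])                  ≡⟨ sub-sub σ (V ∷ₛ var) T ⟩
  sub (sub σ ∘ (V ∷ₛ var)) T       ≡⟨ sub-cong pointwise T ⟩
  sub (sub σ V ∷ₛ σ) T             ≡⟨ ⇑-[] σ (sub σ V) T ⟨
  (sub (⇑ σ) T) [ sub σ V ]        ∎
  where
  open ≡-Reasoning
  pointwise : sub σ ∘ (V ∷ₛ var) ≗ sub σ V ∷ₛ σ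
  pointwise zero    = refl
  pointwise (suc j) = refl

ren-[] : ∀ ρ T V → ren ρ (T [ V ]) ≡ (ren (⇑ʳ ρ) T) [ ren ρ V ]
ren-[] ρ T V = begin
  ren ρ (T [ V ])                                ≡⟨ ren≡sub ρ (T [ V ]) ⟩
  sub (var ∘ ρ) (T [ V ])                        ≡⟨ sub-[] (var ∘ ρ) T V ⟩
  (sub (⇑ (var ∘ ρ)) T) [ sub (var ∘ ρ) V ]      ≡⟨ cong₂ _[_] (sub-cong (⇑-var ρ) T) (ren≡sub ρ V) ⟨
  (sub (var ∘ ⇑ʳ ρ) T) [ ren ρ V ]               ≡⟨ cong (_[ ren ρ V ]) (ren≡sub (⇑ʳ ρ) T) ⟨
  (ren (⇑ʳ ρ) T) [ ren ρ V ]                     ∎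
  where
  open ≡-Reasoning
  ⇑-var : ∀ ρ → var ∘ ⇑ʳ ρ ≗ ⇑ (var ∘ ρ)
  ⇑-var ρ zero    = refl
  ⇑-var ρ (suc j) = refl

liftʳ : ℕ → ℕ → Ren
liftʳ zero    k j = j + k
liftʳ (suc d) k   = ⇑ʳ (liftʳ d k)

lift-var : ∀ d k j → lift d k (var j) ≡ var (liftʳ d k j)
lift-var zero    k j       = refl
lift-var (suc d) k zero    = refl
lift-var (suc d) k (suc j) with j <ᵇ d | lift-var d k j
... | true  | e = cong wk e
... | false | e = cong wk e

lift≡ren : ∀ d k T → lift d k T ≡ ren (liftʳ d k) T
lift≡ren d k (sort h)   = refl
lift≡ren d k (var j)    = lift-var d k j
lift≡ren d k (lam W T)  = cong₂ lam  (lift≡ren d k W) (lift≡ren (suc d) k T)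
lift≡ren d k (abbr V T) = cong₂ abbr (lift≡ren d k V) (lift≡ren (suc d) k T)
lift≡ren d k (appl V T) = cong₂ appl (lift≡ren d k V) (lift≡ren d k T)
lift≡ren d k (cast W T) = cong₂ cast (lift≡ren d k W) (lift≡ren d k T)

wkⁿ : ℕ → Term → Term
wkⁿ zero    T = T
wkⁿ (suc n) T = wk (wkⁿ n T)

wkⁿ≡ren : ∀ n V → wkⁿ n V ≡ ren (_+ n) V
wkⁿ≡ren zero    V = sym (ren-id +-identityʳ V)
wkⁿ≡ren (suc n) V = trans (cong wk (wkⁿ≡ren n V)) (trans (ren-ren suc (_+ n) V) (ren-cong (λ j → sym (+-suc j n)) V))

lift≡wkⁿ : ∀ n V → lift 0 n V ≡ wkⁿ n V
lift≡wkⁿ n V = trans (lift≡ren 0 n V) (sym (wkⁿ≡ren n V))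

lift≡wk : ∀ V → lift 0 1 V ≡ wk V
lift≡wk = lift≡wkⁿ 1

⇑ⁿ : ℕ → Sub → Sub
⇑ⁿ zero    σ = σ
⇑ⁿ (suc n) σ = ⇑ (⇑ⁿ n σ)

insʳ : ℕ → Ren
insʳ zero    = suc
insʳ (suc d) = ⇑ʳ (insʳ d)

substAt : ℕ → Term → Sub
substAt d V = ⇑ⁿ d (V ∷ₛ var)

substAt-insʳ : ∀ d V → substAt d V ∘ insʳ d ≗ var
substAt-insʳ zero    V j       = refl
substAt-insʳ (suc d) V zero    = refl
substAt-insʳ (suc d) V (suc j) = cong wk (substAt-insʳ d V j)

⇑ⁿ-cong : ∀ d → σ ≗ σ′ → ⇑ⁿ d σ ≗ ⇑ⁿ d σ′
⇑ⁿ-cong zero    e = e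
⇑ⁿ-cong (suc d) e = ⇑-cong (⇑ⁿ-cong d e)

⇑ⁿ-id : ∀ d → ⇑ⁿ d var ≗ var
⇑ⁿ-id zero    j = refl
⇑ⁿ-id (suc d)   = ⇑-id (⇑ⁿ-id d)

⇑ⁿ-⇑ : ∀ d σ → ⇑ⁿ d (⇑ σ) ≗ ⇑ⁿ (suc d) σ
⇑ⁿ-⇑ zero    σ j = refl
⇑ⁿ-⇑ (suc d) σ   = ⇑-cong (⇑ⁿ-⇑ d σ)

⇑ⁿ-sub-∘ : ∀ d σ τ → ⇑ⁿ d (sub σ ∘ τ) ≗ sub (⇑ⁿ d σ) ∘ ⇑ⁿ d τ
⇑ⁿ-sub-∘ zero    σ τ j = refl
⇑ⁿ-sub-∘ (suc d) σ τ j = trans (⇑-cong (⇑ⁿ-sub-∘ d σ τ) j) (sym (sub-∘-⇑ (⇑ⁿ d σ) (⇑ⁿ d τ) j))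

infix 4 _⇛_ _⇛*_ _≈_ _⇛ₛ_

-- Unlike →0, an abbreviation is contracted by substituting it everywhere at once (⇛let);
-- this needs no environment and gives the diamond property.
data _⇛_ : Term → Term → Set where
  ⇛sort : ∀ {h} → sort h ⇛ sort h
  ⇛var  : ∀ {j} → var j ⇛ var j
  ⇛lam  : W ⇛ W′ → T ⇛ T′ → lam W T ⇛ lam W′ T′
  ⇛abbr : V ⇛ V′ → T ⇛ T′ → abbr V T ⇛ abbr V′ T′
  ⇛appl : V ⇛ V′ → T ⇛ T′ → appl V T ⇛ appl V′ T′
  ⇛cast : W ⇛ W′ → T ⇛ T′ → cast W T ⇛ cast W′ T′
  ⇛β    : V ⇛ V′ → T ⇛ T′ → appl V (lam W T) ⇛ abbr V′ T′
  ⇛let  : V ⇛ V′ → T ⇛ T′ → abbr V T ⇛ T′ [ V′ ]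
  ⇛τ    : T ⇛ T′ → cast W T ⇛ T′
  ⇛υ    : ∀ {V₁ V₂ V₃ V₄ T₁ T₂} → V₁ ⇛ V₃ → V₂ ⇛ V₄ → T₁ ⇛ T₂ →
          appl V₁ (abbr V₂ T₁) ⇛ abbr V₄ (appl (wk V₃) T₂)

_⇛*_ : Term → Term → Set
_⇛*_ = Star _⇛_

_≈_ : Term → Term → Set
_≈_ = EqClosure _⇛_

⇛-refl : ∀ T → T ⇛ T
⇛-refl (sort h)   = ⇛sort
⇛-refl (var j)    = ⇛var
⇛-refl (lam W T)  = ⇛lam  (⇛-refl W) (⇛-refl T)
⇛-refl (abbr V T) = ⇛abbr (⇛-refl V) (⇛-refl T)
⇛-refl (appl V T) = ⇛appl (⇛-refl V) (⇛-refl T)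
⇛-refl (cast W T) = ⇛cast (⇛-refl W) (⇛-refl T)

⇛-≡ : A ⇛ B → B ≡ C → A ⇛ C
⇛-≡ r refl = r

≡-⇛ : A ≡ B → B ⇛ C → A ⇛ C
≡-⇛ refl r = r

⇛-ren : ∀ ρ → T ⇛ T′ → ren ρ T ⇛ ren ρ T′
⇛-ren ρ ⇛sort         = ⇛sort
⇛-ren ρ ⇛var          = ⇛var
⇛-ren ρ (⇛lam r s)    = ⇛lam  (⇛-ren ρ r) (⇛-ren (⇑ʳ ρ) s)
⇛-ren ρ (⇛abbr r s)   = ⇛abbr (⇛-ren ρ r) (⇛-ren (⇑ʳ ρ) s)
⇛-ren ρ (⇛appl r s)   = ⇛appl (⇛-ren ρ r) (⇛-ren ρ s)
⇛-ren ρ (⇛cast r s)   = ⇛cast (⇛-ren ρ r) (⇛-ren ρ s)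
⇛-ren ρ (⇛β r s)      = ⇛β (⇛-ren ρ r) (⇛-ren (⇑ʳ ρ) s)
⇛-ren ρ (⇛let {V′ = V′} {T′ = T′} r s) =
  ⇛-≡ (⇛let (⇛-ren ρ r) (⇛-ren (⇑ʳ ρ) s)) (sym (ren-[] ρ T′ V′))
⇛-ren ρ (⇛τ r)        = ⇛τ (⇛-ren ρ r)
⇛-ren ρ (⇛υ {V₃ = V₃} {T₂ = T₂} r s t) =
  ⇛-≡ (⇛υ (⇛-ren ρ r) (⇛-ren ρ s) (⇛-ren (⇑ʳ ρ) t)) (cong (λ X → abbr _ (appl X _)) (sym (wk-⇑ʳ ρ V₃)))

_⇛ₛ_ : Sub → Sub → Set
σ ⇛ₛ σ′ = ∀ j → σ j ⇛ σ′ j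

⇛ₛ-refl : ∀ σ → σ ⇛ₛ σ
⇛ₛ-refl σ j = ⇛-refl (σ j)

⇛ₛ-⇑ : σ ⇛ₛ σ′ → ⇑ σ ⇛ₛ ⇑ σ′
⇛ₛ-⇑ r zero    = ⇛var
⇛ₛ-⇑ r (suc j) = ⇛-ren suc (r j)

⇛-sub : σ ⇛ₛ σ′ → T ⇛ T′ → sub σ T ⇛ sub σ′ T′
⇛-sub r ⇛sort          = ⇛sort
⇛-sub r (⇛var {j})     = r j
⇛-sub r (⇛lam s t)     = ⇛lam  (⇛-sub r s) (⇛-sub (⇛ₛ-⇑ r) t)
⇛-sub r (⇛abbr s t)    = ⇛abbr (⇛-sub r s) (⇛-sub (⇛ₛ-⇑ r) t)
⇛-sub r (⇛appl s t)    = ⇛appl (⇛-sub r s) (⇛-sub r t)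
⇛-sub r (⇛cast s t)    = ⇛cast (⇛-sub r s) (⇛-sub r t)
⇛-sub r (⇛β s t)       = ⇛β (⇛-sub r s) (⇛-sub (⇛ₛ-⇑ r) t)
⇛-sub {σ′ = σ′} r (⇛let {V′ = V′} {T′ = T′} s t) =
  ⇛-≡ (⇛let (⇛-sub r s) (⇛-sub (⇛ₛ-⇑ r) t)) (sym (sub-[] σ′ T′ V′))
⇛-sub r (⇛τ t)         = ⇛τ (⇛-sub r t)
⇛-sub {σ′ = σ′} r (⇛υ {V₃ = V₃} s t u) =
  ⇛-≡ (⇛υ (⇛-sub r s) (⇛-sub r t) (⇛-sub (⇛ₛ-⇑ r) u)) (cong (λ X → abbr _ (appl X _)) (sym (sub-⇑-wk σ′ V₃)))

⇛-[] : T ⇛ T′ → V ⇛ V′ → T [ V ] ⇛ T′ [ V′ ]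
⇛-[] t v = ⇛-sub (λ { zero → v ; (suc j) → ⇛var }) t

Joinable : Term → Term → Set
Joinable A B = ∃ λ C → A ⇛ C × B ⇛ C

⇛-diamond : T ⇛ A → T ⇛ B → Joinable A B
⇛-diamond ⇛sort ⇛sort = _ , ⇛sort , ⇛sort
⇛-diamond ⇛var  ⇛var  = _ , ⇛var , ⇛var
⇛-diamond (⇛lam r s) (⇛lam r′ s′)
  with _ , r₁ , r₂ ← ⇛-diamond r r′ | _ , s₁ , s₂ ← ⇛-diamond s s′
  = _ , ⇛lam r₁ s₁ , ⇛lam r₂ s₂
⇛-diamond (⇛abbr r s) (⇛abbr r′ s′)
  with _ , r₁ , r₂ ← ⇛-diamond r r′ | _ , s₁ , s₂ ← ⇛-diamond s s′
  = _ , ⇛abbr r₁ s₁ , ⇛abbr r₂ s₂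
⇛-diamond (⇛abbr r s) (⇛let r′ s′)
  with _ , r₁ , r₂ ← ⇛-diamond r r′ | _ , s₁ , s₂ ← ⇛-diamond s s′
  = _ , ⇛let r₁ s₁ , ⇛-[] s₂ r₂
⇛-diamond (⇛let r s) (⇛abbr r′ s′)
  with _ , r₁ , r₂ ← ⇛-diamond r r′ | _ , s₁ , s₂ ← ⇛-diamond s s′
  = _ , ⇛-[] s₁ r₁ , ⇛let r₂ s₂
⇛-diamond (⇛let r s) (⇛let r′ s′)
  with _ , r₁ , r₂ ← ⇛-diamond r r′ | _ , s₁ , s₂ ← ⇛-diamond s s′
  = _ , ⇛-[] s₁ r₁ , ⇛-[] s₂ r₂
⇛-diamond (⇛appl r s) (⇛appl r′ s′)
  with _ , r₁ , r₂ ← ⇛-diamond r r′ | _ , s₁ , s₂ ← ⇛-diamond s s′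
  = _ , ⇛appl r₁ s₁ , ⇛appl r₂ s₂
⇛-diamond (⇛appl r (⇛lam _ s)) (⇛β r′ s′)
  with _ , r₁ , r₂ ← ⇛-diamond r r′ | _ , s₁ , s₂ ← ⇛-diamond s s′
  = _ , ⇛β r₁ s₁ , ⇛abbr r₂ s₂
⇛-diamond (⇛β r s) (⇛appl r′ (⇛lam _ s′))
  with _ , r₁ , r₂ ← ⇛-diamond r r′ | _ , s₁ , s₂ ← ⇛-diamond s s′
  = _ , ⇛abbr r₁ s₁ , ⇛β r₂ s₂
⇛-diamond (⇛β r s) (⇛β r′ s′)
  with _ , r₁ , r₂ ← ⇛-diamond r r′ | _ , s₁ , s₂ ← ⇛-diamond s s′
  = _ , ⇛abbr r₁ s₁ , ⇛abbr r₂ s₂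
⇛-diamond (⇛appl r (⇛abbr s t)) (⇛υ r′ s′ t′)
  with _ , r₁ , r₂ ← ⇛-diamond r r′ | _ , s₁ , s₂ ← ⇛-diamond s s′ | _ , t₁ , t₂ ← ⇛-diamond t t′
  = _ , ⇛υ r₁ s₁ t₁ , ⇛abbr s₂ (⇛appl (⇛-ren suc r₂) t₂)
⇛-diamond (⇛υ r s t) (⇛appl r′ (⇛abbr s′ t′))
  with _ , r₁ , r₂ ← ⇛-diamond r r′ | _ , s₁ , s₂ ← ⇛-diamond s s′ | _ , t₁ , t₂ ← ⇛-diamond t t′
  = _ , ⇛abbr s₁ (⇛appl (⇛-ren suc r₁) t₁) , ⇛υ r₂ s₂ t₂
⇛-diamond (⇛appl r (⇛let s t)) (⇛υ r′ s′ t′)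
  with V , r₁ , r₂ ← ⇛-diamond r r′ | _ , s₁ , s₂ ← ⇛-diamond s s′ | _ , t₁ , t₂ ← ⇛-diamond t t′
  = _ , ⇛appl r₁ (⇛-[] t₁ s₁) , ⇛-≡ (⇛let s₂ (⇛appl (⇛-ren suc r₂) t₂)) (cong (λ X → appl X _) (wk-[] _ V))
⇛-diamond (⇛υ r s t) (⇛appl r′ (⇛let s′ t′))
  with V , r₁ , r₂ ← ⇛-diamond r r′ | _ , s₁ , s₂ ← ⇛-diamond s s′ | _ , t₁ , t₂ ← ⇛-diamond t t′
  = _ , ⇛-≡ (⇛let s₁ (⇛appl (⇛-ren suc r₁) t₁)) (cong (λ X → appl X _) (wk-[] _ V)) , ⇛appl r₂ (⇛-[] t₂ s₂)
⇛-diamond (⇛υ r s t) (⇛υ r′ s′ t′)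
  with _ , r₁ , r₂ ← ⇛-diamond r r′ | _ , s₁ , s₂ ← ⇛-diamond s s′ | _ , t₁ , t₂ ← ⇛-diamond t t′
  = _ , ⇛abbr s₁ (⇛appl (⇛-ren suc r₁) t₁) , ⇛abbr s₂ (⇛appl (⇛-ren suc r₂) t₂)
⇛-diamond (⇛cast r s) (⇛cast r′ s′)
  with _ , r₁ , r₂ ← ⇛-diamond r r′ | _ , s₁ , s₂ ← ⇛-diamond s s′
  = _ , ⇛cast r₁ s₁ , ⇛cast r₂ s₂
⇛-diamond (⇛cast _ s) (⇛τ s′)
  with _ , s₁ , s₂ ← ⇛-diamond s s′
  = _ , ⇛τ s₁ , s₂
⇛-diamond (⇛τ s) (⇛cast _ s′)
  with _ , s₁ , s₂ ← ⇛-diamond s s′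
  = _ , s₁ , ⇛τ s₂
⇛-diamond (⇛τ s) (⇛τ s′) = ⇛-diamond s s′

⇛-strip : T ⇛ A → T ⇛* B → ∃ λ C → A ⇛* C × B ⇛ C
⇛-strip r ε = _ , ε , r
⇛-strip r (s ◅ ss)
  with _ , r′ , s′ ← ⇛-diamond r s
  with _ , rs , s″ ← ⇛-strip s′ ss
  = _ , r′ ◅ rs , s″

⇛-confluent : Confluent _⇛_
⇛-confluent ε ss = _ , ss , ε
⇛-confluent (r ◅ rs) ss
  with _ , ss′ , r′ ← ⇛-strip r ss
  with _ , rs′ , ss″ ← ⇛-confluent rs ss′
  = _ , rs′ , r′ ◅ ss″

church-rosser : A ≈ B → ∃ λ C → A ⇛* C × B ⇛* C
church-rosser ε = _ , ε , ε
church-rosser (fwd r ◅ p)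
  with _ , rs , ss ← church-rosser p
  = _ , r ◅ rs , ss
church-rosser (bwd r ◅ p)
  with _ , rs , ss ← church-rosser p
  with _ , rs′ , ss′ ← ⇛-confluent (r ◅ ε) rs
  = _ , rs′ , ss ◅◅ ss′

⇛⇒≈ : A ⇛ B → A ≈ B
⇛⇒≈ r = fwd r ◅ ε

≡⇒≈ : A ≡ B → A ≈ B
≡⇒≈ refl = ε

≈-sym : A ≈ B → B ≈ A
≈-sym = symmetric _⇛_

joinable⇒≈ : A ⇛* C → B ⇛* C → A ≈ B
joinable⇒≈ rs ss = a—↠b⇒a↔b rs ◅◅ ≈-sym (a—↠b⇒a↔b ss)

≈-ren : ∀ ρ → A ≈ B → ren ρ A ≈ ren ρ B
≈-ren ρ = gmap (ren ρ) (⇛-ren ρ)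

≈-sub : ∀ σ → A ≈ B → sub σ A ≈ sub σ B
≈-sub σ = gmap (sub σ) (⇛-sub (⇛ₛ-refl σ))

ren-insʳ-≈-injective : ∀ d → ren (insʳ d) A ≈ ren (insʳ d) B → A ≈ B
ren-insʳ-≈-injective {A} {B} d p = subst₂ _≈_ (strengthen A) (strengthen B) (≈-sub (substAt d (sort 0)) p)
  where
  strengthen : ∀ X → sub (substAt d (sort 0)) (ren (insʳ d) X) ≡ X
  strengthen X = trans (sub-ren _ (insʳ d) X) (sub-id (substAt-insʳ d (sort 0)) X)

≈-cong₂ : (f : Term → Term → Term) → (∀ {A A′ B B′} → A ⇛ A′ → B ⇛ B′ → f A B ⇛ f A′ B′) →
          A ≈ A′ → B ≈ B′ → f A B ≈ f A′ B′
≈-cong₂ f f⇛ p q = gmap (λ X → f X _) (λ r → f⇛ r (⇛-refl _)) p ◅◅ gmap (f _) (f⇛ (⇛-refl _)) q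

lam-⇛*-inv : lam W T ⇛* X → ∃₂ λ W′ T′ → X ≡ lam W′ T′ × W ⇛* W′ × T ⇛* T′
lam-⇛*-inv ε = _ , _ , refl , ε , ε
lam-⇛*-inv (⇛lam r s ◅ rs)
  with _ , _ , refl , rs′ , ss′ ← lam-⇛*-inv rs
  = _ , _ , refl , r ◅ rs′ , s ◅ ss′

lam-≈-injective : lam W T ≈ lam W′ T′ → W ≈ W′ × T ≈ T′
lam-≈-injective p
  with _ , rs , ss ← church-rosser p
  with _ , _ , refl , rW , rT ← lam-⇛*-inv rs
  with _ , _ , refl , sW , sT ← lam-⇛*-inv ss
  = joinable⇒≈ rW sW , joinable⇒≈ rT sT

∈FV-ren⁻¹ : ∀ ρ T → i ∈FV ren ρ T → ∃ λ j → j ∈FV T × ρ j ≡ i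
∈FV-ren⁻¹ ρ (var j) fv-var = j , fv-var , refl
∈FV-ren⁻¹ ρ (lam W T) (fv-lamˡ p) with j , q , e ← ∈FV-ren⁻¹ ρ W p = j , fv-lamˡ q , e
∈FV-ren⁻¹ ρ (lam W T) (fv-lamʳ p) with ∈FV-ren⁻¹ (⇑ʳ ρ) T p
... | suc j , q , e = j , fv-lamʳ q , suc-injective e
∈FV-ren⁻¹ ρ (abbr V T) (fv-abbrˡ p) with j , q , e ← ∈FV-ren⁻¹ ρ V p = j , fv-abbrˡ q , e
∈FV-ren⁻¹ ρ (abbr V T) (fv-abbrʳ p) with ∈FV-ren⁻¹ (⇑ʳ ρ) T p
... | suc j , q , e = j , fv-abbrʳ q , suc-injective e
∈FV-ren⁻¹ ρ (appl V T) (fv-applˡ p) with j , q , e ← ∈FV-ren⁻¹ ρ V p = j , fv-applˡ q , e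
∈FV-ren⁻¹ ρ (appl V T) (fv-applʳ p) with j , q , e ← ∈FV-ren⁻¹ ρ T p = j , fv-applʳ q , e
∈FV-ren⁻¹ ρ (cast W T) (fv-castˡ p) with j , q , e ← ∈FV-ren⁻¹ ρ W p = j , fv-castˡ q , e
∈FV-ren⁻¹ ρ (cast W T) (fv-castʳ p) with j , q , e ← ∈FV-ren⁻¹ ρ T p = j , fv-castʳ q , e

∉FV-lift : ∀ i V → ¬ i ∈FV lift 0 (suc i) V
∉FV-lift i V p with j , _ , e ← ∈FV-ren⁻¹ (liftʳ 0 (suc i)) V (subst (i ∈FV_) (lift≡ren 0 (suc i) V) p)
  = m≢1+n+m i (sym (trans (sym (+-suc j i)) e))

∉FV-wk : ∀ T → ¬ 0 ∈FV wk T
∉FV-wk T p with ∈FV-ren⁻¹ suc T p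
... | _ , _ , ()

Rep-false⇒≡ : Rep b i W T T′ → b ≡ false → T ≡ T′
Rep-false⇒≡ rep-sort e = refl
Rep-false⇒≡ rep-keep e = refl
Rep-false⇒≡ (rep-lam {b} {c} r s) e =
  cong₂ lam (Rep-false⇒≡ r (∨-conicalˡ b c e)) (Rep-false⇒≡ s (∨-conicalʳ b c e))
Rep-false⇒≡ (rep-abbr {b} {c} r s) e =
  cong₂ abbr (Rep-false⇒≡ r (∨-conicalˡ b c e)) (Rep-false⇒≡ s (∨-conicalʳ b c e))
Rep-false⇒≡ (rep-appl {b} {c} r s) e =
  cong₂ appl (Rep-false⇒≡ r (∨-conicalˡ b c e)) (Rep-false⇒≡ s (∨-conicalʳ b c e))
Rep-false⇒≡ (rep-cast {b} {c} r s) e =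
  cong₂ cast (Rep-false⇒≡ r (∨-conicalˡ b c e)) (Rep-false⇒≡ s (∨-conicalʳ b c e))

Rep-true⇒∈FV : Rep b i W T T′ → b ≡ true → i ∈FV T
Rep-true⇒∈FV rep-hit e = fv-var
Rep-true⇒∈FV (rep-lam  {true} r s) e = fv-lamˡ  (Rep-true⇒∈FV r refl)
Rep-true⇒∈FV (rep-lam  {false} r s) e = fv-lamʳ  (Rep-true⇒∈FV s e)
Rep-true⇒∈FV (rep-abbr {true} r s) e = fv-abbrˡ (Rep-true⇒∈FV r refl)
Rep-true⇒∈FV (rep-abbr {false} r s) e = fv-abbrʳ (Rep-true⇒∈FV s e)
Rep-true⇒∈FV (rep-appl {true} r s) e = fv-applˡ (Rep-true⇒∈FV r refl)
Rep-true⇒∈FV (rep-appl {false} r s) e = fv-applʳ (Rep-true⇒∈FV s e)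
Rep-true⇒∈FV (rep-cast {true} r s) e = fv-castˡ (Rep-true⇒∈FV r refl)
Rep-true⇒∈FV (rep-cast {false} r s) e = fv-castʳ (Rep-true⇒∈FV s e)

sub-⇑-lift : ∀ σ W → sub σ W ≡ σ i → sub (⇑ σ) (lift 0 1 W) ≡ ⇑ σ (suc i)
sub-⇑-lift σ W e = trans (cong (sub (⇑ σ)) (lift≡wk W)) (trans (sub-⇑-wk σ W) (cong wk e))

sub-cong-Rep : Rep b i W T T′ → ∀ σ → sub σ W ≡ σ i → sub σ T ≡ sub σ T′
sub-cong-Rep rep-sort σ e = refl
sub-cong-Rep rep-keep σ e = refl
sub-cong-Rep rep-hit  σ e = sym e
sub-cong-Rep {W = W} (rep-lam r s)  σ e = cong₂ lam  (sub-cong-Rep r σ e) (sub-cong-Rep s (⇑ σ) (sub-⇑-lift σ W e))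
sub-cong-Rep {W = W} (rep-abbr r s) σ e = cong₂ abbr (sub-cong-Rep r σ e) (sub-cong-Rep s (⇑ σ) (sub-⇑-lift σ W e))
sub-cong-Rep (rep-appl r s) σ e = cong₂ appl (sub-cong-Rep r σ e) (sub-cong-Rep s σ e)
sub-cong-Rep (rep-cast r s) σ e = cong₂ cast (sub-cong-Rep r σ e) (sub-cong-Rep s σ e)

IdExcept : Sub → ℕ → Set
IdExcept σ i = ∀ j → j ≢ i → σ j ≡ var j

⇑-IdExcept : IdExcept σ i → IdExcept (⇑ σ) (suc i)
⇑-IdExcept fix zero    _  = refl
⇑-IdExcept fix (suc j) ne = cong wk (fix j (ne ∘ cong suc))

Rep-sub : ∀ σ → σ i ≡ W → IdExcept σ i → ∀ T → ∃ λ b → Rep b i W T (sub σ T)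
Rep-sub σ e fix (sort h) = false , rep-sort
Rep-sub {i} σ e fix (var j) with j ≟ i
... | yes refl = true  , subst (Rep true i _ (var i)) (sym e) rep-hit
... | no  ne   = false , subst (Rep false i _ (var j)) (sym (fix j ne)) rep-keep
Rep-sub {W = W} σ e fix (lam A T)
  with b , r ← Rep-sub σ e fix A
     | c , s ← Rep-sub (⇑ σ) (trans (cong wk e) (sym (lift≡wk W))) (⇑-IdExcept fix) T
  = b ∨ c , rep-lam r s
Rep-sub {W = W} σ e fix (abbr A T)
  with b , r ← Rep-sub σ e fix A
     | c , s ← Rep-sub (⇑ σ) (trans (cong wk e) (sym (lift≡wk W))) (⇑-IdExcept fix) T
  = b ∨ c , rep-abbr r s
Rep-sub σ e fix (appl A T)
  with b , r ← Rep-sub σ e fix A | c , s ← Rep-sub σ e fix T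
  = b ∨ c , rep-appl r s
Rep-sub σ e fix (cast A T)
  with b , r ← Rep-sub σ e fix A | c , s ← Rep-sub σ e fix T
  = b ∨ c , rep-cast r s

-- Unfolds variable 0 in place: its binder stays, now vacuous, so no index moves.
unfoldHead : Term → Sub
unfoldHead V = wk V ∷ₛ var ∘ suc

⇑ⁿ-unfoldHead-at : ∀ d V → ⇑ⁿ d (unfoldHead V) d ≡ lift 0 (suc d) V
⇑ⁿ-unfoldHead-at d V = trans (at-wkⁿ d) (sym (lift≡wkⁿ (suc d) V))
  where
  at-wkⁿ : ∀ d → ⇑ⁿ d (unfoldHead V) d ≡ wkⁿ (suc d) V
  at-wkⁿ zero    = refl
  at-wkⁿ (suc d) = cong wk (at-wkⁿ d)

⇑ⁿ-unfoldHead-IdExcept : ∀ d V → IdExcept (⇑ⁿ d (unfoldHead V)) d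
⇑ⁿ-unfoldHead-IdExcept zero    V zero    ne = ⊥-elim (ne refl)
⇑ⁿ-unfoldHead-IdExcept zero    V (suc j) _  = refl
⇑ⁿ-unfoldHead-IdExcept (suc d) V            = ⇑-IdExcept (⇑ⁿ-unfoldHead-IdExcept d V)

unfoldHead-[] : ∀ V T → sub (unfoldHead V) T ≡ wk (T [ V ])
unfoldHead-[] V T = trans (sub-cong pointwise T) (sym (ren-sub suc (V ∷ₛ var) T))
  where
  pointwise : unfoldHead V ≗ wk ∘ (V ∷ₛ var)
  pointwise zero    = refl
  pointwise (suc j) = refl

Rep-unfoldHead : ∀ d V T → ∃ λ b → Rep b d (lift 0 (suc d) V) T (sub (⇑ⁿ d (unfoldHead V)) T)
Rep-unfoldHead d V = Rep-sub (⇑ⁿ d (unfoldHead V)) (⇑ⁿ-unfoldHead-at d V) (⇑ⁿ-unfoldHead-IdExcept d V)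

data Item : Set where
  decl : Term → Item
  defn : Term → Item

Ctx : Set
Ctx = List Item

private
  variable
    I I′ J : Item
    Γ Γ′ Γ₁ Δ Δ′ : Ctx

data At : Ctx → ℕ → Item → Ctx → Set where
  here  : At (I ∷ Γ) 0 I Γ
  there : At Γ k I Δ → At (J ∷ Γ) (suc k) I Δ

At-functional : At Γ k I Δ → At Γ k I′ Δ′ → I ≡ I′ × Δ ≡ Δ′
At-functional here      here      = refl , refl
At-functional (there a) (there b) = At-functional a b

data Drop : ℕ → Ctx → Ctx → Set where
  stop : Drop 0 Γ Γ
  pop  : Drop n Γ Δ → Drop (suc n) (I ∷ Γ) Δ

At⇒Drop : At Γ k I Δ → Drop (suc k) Γ Δ
At⇒Drop here      = pop stop
At⇒Drop (there a) = pop (At⇒Drop a)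

Drop-∷ : Drop d Γ (I ∷ Δ) → Drop (suc d) Γ Δ
Drop-∷ stop    = pop stop
Drop-∷ (pop p) = pop (Drop-∷ p)

Drop⇒At : Drop d Γ (I ∷ Δ) → At Γ d I Δ
Drop⇒At stop    = here
Drop⇒At (pop p) = there (Drop⇒At p)

unfold : Ctx → Sub
unfold []           = var
unfold (decl W ∷ Γ) = ⇑ (unfold Γ)
unfold (defn V ∷ Γ) = wk (sub (unfold Γ) V) ∷ₛ wk ∘ unfold Γ

unfold-suc : ∀ I Γ → unfold (I ∷ Γ) ∘ suc ≗ wk ∘ unfold Γ
unfold-suc (decl W) Γ k = refl
unfold-suc (defn V) Γ k = refl

sub-unfold-wk : ∀ I Γ A → sub (unfold (I ∷ Γ)) (wk A) ≡ wk (sub (unfold Γ) A)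
sub-unfold-wk I Γ A =
  trans (sub-ren (unfold (I ∷ Γ)) suc A) (trans (sub-cong (unfold-suc I Γ) A) (sym (ren-sub suc (unfold Γ) A)))

sub-unfold-wkⁿ : Drop n Γ Δ → ∀ A → sub (unfold Γ) (wkⁿ n A) ≡ wkⁿ n (sub (unfold Δ) A)
sub-unfold-wkⁿ stop A = refl
sub-unfold-wkⁿ (pop {n} {Γ} {I = I} p) A = trans (sub-unfold-wk I Γ (wkⁿ n A)) (cong wk (sub-unfold-wkⁿ p A))

unfold-defn : At Γ k (defn V) Δ → unfold Γ k ≡ wkⁿ (suc k) (sub (unfold Δ) V)
unfold-defn here = refl
unfold-defn {Γ = I ∷ Γ} (there {k = k} a) = trans (unfold-suc I Γ k) (cong wk (unfold-defn a))

unfold-decl : At Γ k (decl W) Δ → unfold Γ k ≡ var k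
unfold-decl here = refl
unfold-decl {Γ = I ∷ Γ} (there {k = k} a) = trans (unfold-suc I Γ k) (cong wk (unfold-decl a))

unfold-idempotent : ∀ Γ → sub (unfold Γ) ∘ unfold Γ ≗ unfold Γ
unfold-idempotent []           j       = refl
unfold-idempotent (decl W ∷ Γ) zero    = refl
unfold-idempotent (defn V ∷ Γ) zero    =
  trans (sub-unfold-wk (defn V) Γ (sub (unfold Γ) V))
        (cong wk (trans (sub-sub (unfold Γ) (unfold Γ) V) (sub-cong (unfold-idempotent Γ) V)))
unfold-idempotent (I ∷ Γ)      (suc j) =
  trans (cong (sub (unfold (I ∷ Γ))) (unfold-suc I Γ j))
        (trans (sub-unfold-wk I Γ (unfold Γ j)) (trans (cong wk (unfold-idempotent Γ j)) (sym (unfold-suc I Γ j))))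

infix 4 _⊩_≅_

record _⊩_≅_ (Γ : Ctx) (A B : Term) : Set where
  constructor via-unfold
  field unfolded : sub (unfold Γ) A ≈ sub (unfold Γ) B

≅-refl : Γ ⊩ A ≅ A
≅-refl = via-unfold ε

≅-sym : Γ ⊩ A ≅ B → Γ ⊩ B ≅ A
≅-sym (via-unfold p) = via-unfold (≈-sym p)

≅-trans : Γ ⊩ A ≅ B → Γ ⊩ B ≅ C → Γ ⊩ A ≅ C
≅-trans (via-unfold p) (via-unfold q) = via-unfold (p ◅◅ q)

⇛⇒≅ : A ⇛ B → Γ ⊩ A ≅ B
⇛⇒≅ {Γ = Γ} r = via-unfold (⇛⇒≈ (⇛-sub (⇛ₛ-refl (unfold Γ)) r))

⇚⇒≅ : B ⇛ A → Γ ⊩ A ≅ B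
⇚⇒≅ r = ≅-sym (⇛⇒≅ r)

≅-lam : Γ ⊩ W ≅ W′ → decl W ∷ Γ ⊩ U ≅ U′ → Γ ⊩ lam W U ≅ lam W′ U′
≅-lam (via-unfold p) (via-unfold q) = via-unfold (≈-cong₂ lam ⇛lam p q)

≅-appl : Γ ⊩ V ≅ V′ → Γ ⊩ U ≅ U′ → Γ ⊩ appl V U ≅ appl V′ U′
≅-appl (via-unfold p) (via-unfold q) = via-unfold (≈-cong₂ appl ⇛appl p q)

≅-cast : Γ ⊩ W ≅ W′ → Γ ⊩ U ≅ U′ → Γ ⊩ cast W U ≅ cast W′ U′
≅-cast (via-unfold p) (via-unfold q) = via-unfold (≈-cong₂ cast ⇛cast p q)

≅-abbrˡ : Γ ⊩ V ≅ V′ → Γ ⊩ abbr V U ≅ abbr V′ U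
≅-abbrˡ (via-unfold p) = via-unfold (≈-cong₂ abbr ⇛abbr p ε)

≅-wkⁿ : Drop n Γ Δ → Δ ⊩ A ≅ B → Γ ⊩ wkⁿ n A ≅ wkⁿ n B
≅-wkⁿ {n} {A = A} {B} p (via-unfold q) =
  via-unfold (subst₂ _≈_ (sym (sub-unfold-wkⁿ p A)) (sym (sub-unfold-wkⁿ p B)) (≈-wkⁿ n q))
  where
  ≈-wkⁿ : ∀ n → A′ ≈ B′ → wkⁿ n A′ ≈ wkⁿ n B′
  ≈-wkⁿ zero    r = r
  ≈-wkⁿ (suc n) r = ≈-ren suc (≈-wkⁿ n r)

abbr-≈-unfold : ∀ Γ V U → sub (unfold Γ) (abbr V U) ≈ sub (sub (unfold Γ) V ∷ₛ unfold Γ) U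
abbr-≈-unfold Γ V U = ⇛⇒≈ (⇛-≡ (⇛let (⇛-refl _) (⇛-refl _)) (⇑-[] (unfold Γ) (sub (unfold Γ) V) U))

unfold-∷-defn : ∀ V Γ U → sub (unfold (defn V ∷ Γ)) U ≡ wk (sub (sub (unfold Γ) V ∷ₛ unfold Γ) U)
unfold-∷-defn V Γ U = trans (sub-cong pointwise U) (sym (ren-sub suc (sub (unfold Γ) V ∷ₛ unfold Γ) U))
  where
  pointwise : unfold (defn V ∷ Γ) ≗ wk ∘ (sub (unfold Γ) V ∷ₛ unfold Γ)
  pointwise zero    = refl
  pointwise (suc j) = refl

≅-abbrʳ : defn V ∷ Γ ⊩ U ≅ U′ → Γ ⊩ abbr V U ≅ abbr V U′
≅-abbrʳ {V} {Γ} {U} {U′} (via-unfold p) = via-unfold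
  (abbr-≈-unfold Γ V U ◅◅ ren-insʳ-≈-injective 0 (subst₂ _≈_ (unfold-∷-defn V Γ U) (unfold-∷-defn V Γ U′) p)
                       ◅◅ ≈-sym (abbr-≈-unfold Γ V U′))

abbr-≅-body : Γ ⊩ abbr V U ≅ A → defn V ∷ Γ ⊩ U ≅ wk A
abbr-≅-body {Γ} {V} {U} {A} (via-unfold p) = via-unfold
  (subst₂ _≈_ (sym (unfold-∷-defn V Γ U)) (sym (sub-unfold-wk (defn V) Γ A))
    (≈-ren suc (≈-sym (abbr-≈-unfold Γ V U) ◅◅ p)))

renItem : Ren → Item → Item
renItem ρ (decl W) = decl (ren ρ W)
renItem ρ (defn V) = defn (ren ρ V)

data Ins : ℕ → Ctx → Ctx → Set where
  ins-here  : Ins 0 Γ (I ∷ Γ)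
  ins-there : Ins d Γ Γ′ → Ins (suc d) (J ∷ Γ) (renItem (insʳ d) J ∷ Γ′)

sub-ren-commute : ∀ {σ σ′ ρ} → (∀ j → σ′ (ρ j) ≡ ren ρ (σ j)) → ∀ A → sub σ′ (ren ρ A) ≡ ren ρ (sub σ A)
sub-ren-commute {σ} {σ′} {ρ} e A = trans (sub-ren σ′ ρ A) (trans (sub-cong e A) (sym (ren-sub ρ σ A)))

unfold-Ins : Ins d Γ Γ′ → ∀ j → unfold Γ′ (insʳ d j) ≡ ren (insʳ d) (unfold Γ j)
unfold-Ins {Γ = Γ} (ins-here {I = I}) j = unfold-suc I Γ j
unfold-Ins (ins-there {J = decl W} p) zero = refl
unfold-Ins (ins-there {d} {Γ} {J = defn V} p) zero =
  trans (cong wk (sub-ren-commute (unfold-Ins p) V)) (sym (wk-⇑ʳ (insʳ d) (sub (unfold Γ) V)))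
unfold-Ins (ins-there {d} {Γ} {Γ′} {J} p) (suc j) = begin
  unfold (renItem (insʳ d) J ∷ Γ′) (suc (insʳ d j))  ≡⟨ unfold-suc (renItem (insʳ d) J) Γ′ (insʳ d j) ⟩
  wk (unfold Γ′ (insʳ d j))                          ≡⟨ cong wk (unfold-Ins p j) ⟩
  wk (ren (insʳ d) (unfold Γ j))                     ≡⟨ wk-⇑ʳ (insʳ d) (unfold Γ j) ⟨
  ren (insʳ (suc d)) (wk (unfold Γ j))               ≡⟨ cong (ren (insʳ (suc d))) (unfold-suc J Γ j) ⟨
  ren (insʳ (suc d)) (unfold (J ∷ Γ) (suc j))        ∎
  where open ≡-Reasoning

≅-Ins : Ins d Γ Γ′ → Γ ⊩ A ≅ B → Γ′ ⊩ ren (insʳ d) A ≅ ren (insʳ d) B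
≅-Ins {d} {A = A} {B} p (via-unfold q) = via-unfold
  (subst₂ _≈_ (sym (sub-ren-commute (unfold-Ins p) A)) (sym (sub-ren-commute (unfold-Ins p) B)) (≈-ren (insʳ d) q))

-- Where the entry k of Γ lands in Γ′ (shallower: k < d, deeper: k ≥ d), and how insʳ d acts
-- on var k and on the types the entry assigns.
data AtIns (d : ℕ) (Γ′ : Ctx) (k : ℕ) (I : Item) (Δ : Ctx) : Set where
  shallower : ∀ {d′ Δ′} → Ins d′ Δ Δ′ → At Γ′ k (renItem (insʳ d′) I) Δ′ → insʳ d k ≡ k →
              (∀ W → ren (insʳ d) (wkⁿ (suc k) W) ≡ wkⁿ (suc k) (ren (insʳ d′) W)) → AtIns d Γ′ k I Δ
  deeper    : At Γ′ (suc k) I Δ → insʳ d k ≡ suc k →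
              (∀ W → ren (insʳ d) (wkⁿ (suc k) W) ≡ wkⁿ (suc (suc k)) W) → AtIns d Γ′ k I Δ

At-Ins : Ins d Γ Γ′ → At Γ k I Δ → AtIns d Γ′ k I Δ
At-Ins ins-here a = deeper (there a) refl (λ W → refl)
At-Ins (ins-there {d} p) here = shallower p here refl (wk-⇑ʳ (insʳ d))
At-Ins (ins-there {d} p) (there {k = k} a) with At-Ins p a
... | shallower q a′ e f = shallower q (there a′) (cong suc e) (λ W → ren-⇑ʳ-wk-cong (insʳ d) (wkⁿ (suc k) W) (f W))
... | deeper a′ e f      = deeper (there a′) (cong suc e) (λ W → ren-⇑ʳ-wk-cong (insʳ d) (wkⁿ (suc k) W) (f W))

data Replace (I I′ : Item) (Γ₁ : Ctx) : ℕ → Ctx → Ctx → Set where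
  replace-here  : Replace I I′ Γ₁ 0 (I ∷ Γ₁) (I′ ∷ Γ₁)
  replace-there : Replace I I′ Γ₁ d Γ Γ′ → Replace I I′ Γ₁ (suc d) (J ∷ Γ) (J ∷ Γ′)

Replace⇒At : Replace I I′ Γ₁ d Γ Γ′ → At Γ′ d I′ Γ₁
Replace⇒At replace-here      = here
Replace⇒At (replace-there p) = there (Replace⇒At p)

data AtReplace (I I′ : Item) (Γ₁ : Ctx) (d : ℕ) (Γ′ : Ctx) : ℕ → Item → Ctx → Set where
  shallower : ∀ {k J Δ Δ′ d′} → At Γ′ k J Δ′ → Replace I I′ Γ₁ d′ Δ Δ′ → AtReplace I I′ Γ₁ d Γ′ k J Δ
  replaced  : AtReplace I I′ Γ₁ d Γ′ d I Γ₁
  deeper    : ∀ {k J Δ} → At Γ′ k J Δ → AtReplace I I′ Γ₁ d Γ′ k J Δ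

At-Replace : Replace I I′ Γ₁ d Γ Γ′ → At Γ k J Δ → AtReplace I I′ Γ₁ d Γ′ k J Δ
At-Replace replace-here      here      = replaced
At-Replace replace-here      (there a) = deeper (there a)
At-Replace (replace-there p) here      = shallower here p
At-Replace (replace-there p) (there a) with At-Replace p a
... | shallower a′ q = shallower (there a′) q
... | replaced       = replaced
... | deeper a′      = deeper (there a′)

-- Conversion transfers from Γ to Γ′ when unfolding in Γ′ is a reduct of an instance of
-- unfolding in Γ; this covers all the context changes used below.
record Refines (Γ Γ′ : Ctx) : Set where
  constructor refines
  field
    {instance-of} : Sub
    reduces : sub instance-of ∘ unfold Γ ⇛ₛ unfold Γ′

⇛ₛ⇒Refines : unfold Γ ⇛ₛ unfold Γ′ → Refines Γ Γ′
⇛ₛ⇒Refines {Γ} r = refines (λ j → ≡-⇛ (sub-id (λ _ → refl) (unfold Γ j)) (r j))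

Refines-∷ : ∀ J → Refines Γ Γ′ → Refines (J ∷ Γ) (J ∷ Γ′)
Refines-∷ {Γ} {Γ′} J (refines {τ} r) = refines (unfold-⇛ J)
  where
  unfold-⇛ : ∀ J → sub (⇑ τ) ∘ unfold (J ∷ Γ) ⇛ₛ unfold (J ∷ Γ′)
  unfold-⇛ (decl W) zero = ⇛var
  unfold-⇛ (defn V) zero =
    ≡-⇛ (sub-⇑-wk τ (sub (unfold Γ) V)) (⇛-ren suc (≡-⇛ (sub-sub τ (unfold Γ) V) (⇛-sub r (⇛-refl V))))
  unfold-⇛ J (suc j) = ≡-⇛ (cong (sub (⇑ τ)) (unfold-suc J Γ j))
    (≡-⇛ (sub-⇑-wk τ (unfold Γ j)) (⇛-≡ (⇛-ren suc (r j)) (sym (unfold-suc J Γ′ j))))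

Refines-Replace : Refines (I ∷ Γ₁) (I′ ∷ Γ₁) → Replace I I′ Γ₁ d Γ Γ′ → Refines Γ Γ′
Refines-Replace ref replace-here                = ref
Refines-Replace ref (replace-there {J = J} p) = Refines-∷ J (Refines-Replace ref p)

≅-Refines : Refines Γ Γ′ → Γ ⊩ A ≅ B → Γ′ ⊩ A ≅ B
≅-Refines {Γ} {Γ′} {A} {B} (refines {τ} r) (via-unfold p) =
  via-unfold (≈-sym (⇛⇒≈ (unfold-⇛ A)) ◅◅ ≈-sub τ p ◅◅ ⇛⇒≈ (unfold-⇛ B))
  where
  unfold-⇛ : ∀ X → sub τ (sub (unfold Γ) X) ⇛ sub (unfold Γ′) X
  unfold-⇛ X = ≡-⇛ (sub-sub τ (unfold Γ) X) (⇛-sub r (⇛-refl X))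

subItem : Sub → Item → Item
subItem σ (decl W) = decl (sub σ W)
subItem σ (defn V) = defn (sub σ V)

data Inline (V : Term) (Γ₁ : Ctx) : ℕ → Ctx → Ctx → Set where
  inline-here  : Inline V Γ₁ 0 (defn V ∷ Γ₁) Γ₁
  inline-there : Inline V Γ₁ d Γ Γ′ → Inline V Γ₁ (suc d) (J ∷ Γ) (subItem (substAt d V) J ∷ Γ′)

data AtInline (V : Term) (Γ₁ : Ctx) (d : ℕ) (Γ′ : Ctx) : ℕ → Item → Ctx → Set where
  shallower : ∀ {k J Δ d′ Δ′} → Inline V Γ₁ d′ Δ Δ′ → At Γ′ k (subItem (substAt d′ V) J) Δ′ →
              substAt d V k ≡ var k →
              (∀ W → sub (substAt d V) (wkⁿ (suc k) W) ≡ wkⁿ (suc k) (sub (substAt d′ V) W)) →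
              AtInline V Γ₁ d Γ′ k J Δ
  inlined   : Drop d Γ′ Γ₁ → substAt d V d ≡ wkⁿ d V →
              (∀ W → sub (substAt d V) (wkⁿ (suc d) W) ≡ wkⁿ d W) →
              AtInline V Γ₁ d Γ′ d (defn V) Γ₁
  deeper    : ∀ {k J Δ} → At Γ′ k J Δ → substAt d V (suc k) ≡ var k →
              (∀ W → sub (substAt d V) (wkⁿ (suc (suc k)) W) ≡ wkⁿ (suc k) W) →
              AtInline V Γ₁ d Γ′ (suc k) J Δ

At-Inline : Inline V Γ₁ d Γ Γ′ → At Γ k J Δ → AtInline V Γ₁ d Γ′ k J Δ
At-Inline {V} inline-here here      = inlined stop refl (wk-[] V)
At-Inline {V} inline-here (there a) = deeper a refl (λ W → wk-[] V _)
At-Inline {V} (inline-there {d} p) here = shallower p here refl (sub-⇑-wk (substAt d V))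
At-Inline {V} (inline-there {d} p) (there {k = k} a) with At-Inline p a
... | shallower q a′ e f = shallower q (there a′) (cong wk e) (λ W → sub-⇑-wk-cong (substAt d V) (wkⁿ (suc k) W) (f W))
... | inlined q e f      = inlined (pop q) (cong wk e) (λ W → sub-⇑-wk-cong (substAt d V) (wkⁿ (suc k) W) (f W))
... | deeper a′ e f      = deeper (there a′) (cong wk e) (λ W → sub-⇑-wk-cong (substAt d V) (wkⁿ (suc k) W) (f W))

unfold-Inline : ∀ {V Γ₁ d Γ Γ′} → Inline V Γ₁ d Γ Γ′ → ∀ j → unfold Γ j ≡ ren (insʳ d) (sub (unfold Γ′) (substAt d V j))
sub-unfold-Inline : ∀ {V Γ₁ d Γ Γ′} → Inline V Γ₁ d Γ Γ′ → ∀ X →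
                    sub (unfold Γ) X ≡ ren (insʳ d) (sub (unfold Γ′) (sub (substAt d V) X))

sub-unfold-Inline {V} {d = d} {Γ} {Γ′} p X = begin
  sub (unfold Γ) X                                      ≡⟨ sub-cong (unfold-Inline p) X ⟩
  sub (ren (insʳ d) ∘ sub (unfold Γ′) ∘ substAt d V) X  ≡⟨ ren-sub (insʳ d) _ X ⟨
  ren (insʳ d) (sub (sub (unfold Γ′) ∘ substAt d V) X)  ≡⟨ cong (ren (insʳ d)) (sub-sub (unfold Γ′) (substAt d V) X) ⟨
  ren (insʳ d) (sub (unfold Γ′) (sub (substAt d V) X))  ∎
  where open ≡-Reasoning

unfold-Inline inline-here zero    = refl
unfold-Inline inline-here (suc j) = refl
unfold-Inline (inline-there {J = decl W} p) zero = refl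
unfold-Inline (inline-there {d} {J = defn U} p) zero =
  trans (cong wk (sub-unfold-Inline p U)) (sym (wk-⇑ʳ (insʳ d) _))
unfold-Inline {V} (inline-there {d} {Γ} {Γ′} {J} p) (suc j) = begin
  unfold (J ∷ Γ) (suc j)
    ≡⟨ unfold-suc J Γ j ⟩
  wk (unfold Γ j)
    ≡⟨ cong wk (unfold-Inline p j) ⟩
  wk (ren (insʳ d) (sub (unfold Γ′) (substAt d V j)))
    ≡⟨ wk-⇑ʳ (insʳ d) _ ⟨
  ren (insʳ (suc d)) (wk (sub (unfold Γ′) (substAt d V j)))
    ≡⟨ cong (ren (insʳ (suc d))) (sub-unfold-wk J′ Γ′ (substAt d V j)) ⟨
  ren (insʳ (suc d)) (sub (unfold (J′ ∷ Γ′)) (wk (substAt d V j)))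
    ∎
  where
  open ≡-Reasoning
  J′ = subItem (substAt d V) J

≅-Inline : Inline V Γ₁ d Γ Γ′ → Γ ⊩ A ≅ B → Γ′ ⊩ sub (substAt d V) A ≅ sub (substAt d V) B
≅-Inline {d = d} {A = A} {B} p (via-unfold q) =
  via-unfold (ren-insʳ-≈-injective d (subst₂ _≈_ (sub-unfold-Inline p A) (sub-unfold-Inline p B) q))

lam-≅-domain : Γ ⊩ lam W U ≅ lam W′ U′ → Γ ⊩ W ≅ W′
lam-≅-domain (via-unfold p) = via-unfold (proj₁ (lam-≈-injective p))

⇑ⁿ-unfold-var : Drop d Γ Γ₁ → ∀ k → ⇑ⁿ d (unfold Γ₁) k ≡ var k ⊎ ⇑ⁿ d (unfold Γ₁) k ≡ unfold Γ k
⇑ⁿ-unfold-var stop    k       = inj₂ refl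
⇑ⁿ-unfold-var (pop p) zero    = inj₁ refl
⇑ⁿ-unfold-var (pop {Γ = Γ} {I = I} p) (suc k) with ⇑ⁿ-unfold-var p k
... | inj₁ e = inj₁ (cong wk e)
... | inj₂ e = inj₂ (trans (cong wk e) (sym (unfold-suc I Γ k)))

unfold-⇑ⁿ-unfold : Drop d Γ Γ₁ → sub (unfold Γ) ∘ ⇑ⁿ d (unfold Γ₁) ≗ unfold Γ
unfold-⇑ⁿ-unfold {Γ = Γ} stop = unfold-idempotent Γ
unfold-⇑ⁿ-unfold (pop p) zero = refl
unfold-⇑ⁿ-unfold (pop {n} {Γ} {Δ} {I} p) (suc j) =
  trans (sub-unfold-wk I Γ (⇑ⁿ n (unfold Δ) j)) (trans (cong wk (unfold-⇑ⁿ-unfold p j)) (sym (unfold-suc I Γ j)))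

⇑ⁿ-unfold-≅ : Drop d Γ Γ₁ → ∀ A → Γ ⊩ sub (⇑ⁿ d (unfold Γ₁)) A ≅ A
⇑ⁿ-unfold-≅ {d} {Γ} {Γ₁} p A =
  via-unfold (≡⇒≈ (trans (sub-sub (unfold Γ) (⇑ⁿ d (unfold Γ₁)) A) (sub-cong (unfold-⇑ⁿ-unfold p) A)))

infixl 5 _▷_

-- Γ ▷ E pushes the binders of E onto Γ, so ctx E lists them innermost first and the
-- de Bruijn index k refers to its k-th entry; appl and cast items bind nothing.
_▷_ : Ctx → Env → Ctx
Γ ▷ sortE h   = Γ
Γ ▷ lamE W C  = (decl W ∷ Γ) ▷ C
Γ ▷ abbrE V C = (defn V ∷ Γ) ▷ C
Γ ▷ applE V C = Γ ▷ C
Γ ▷ castE W C = Γ ▷ C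

ctx : Env → Ctx
ctx E = [] ▷ E

▷-graft : ∀ C₁ C₂ Γ → Γ ▷ graft C₁ C₂ ≡ Γ ▷ C₁ ▷ C₂
▷-graft (sortE h)   C₂ Γ = refl
▷-graft (lamE W C)  C₂ Γ = ▷-graft C C₂ (decl W ∷ Γ)
▷-graft (abbrE V C) C₂ Γ = ▷-graft C C₂ (defn V ∷ Γ)
▷-graft (applE V C) C₂ Γ = ▷-graft C C₂ Γ
▷-graft (castE W C) C₂ Γ = ▷-graft C C₂ Γ

ctx-∙δ : ∀ E V → ctx (E ∙δ V) ≡ defn V ∷ ctx E
ctx-∙δ E V = ▷-graft E _ []

ctx-∙λ : ∀ E W → ctx (E ∙λ W) ≡ decl W ∷ ctx E
ctx-∙λ E W = ▷-graft E _ []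

itemEnv : Item → Env → Env
itemEnv (decl W) = lamE W
itemEnv (defn V) = abbrE V

At-reindex : ∀ {Γ m n I Δ} → At Γ m I Δ → m ≡ n → At Γ n I Δ
At-reindex a refl = a

At-▷ : ∀ C {Γ k I Δ} → At Γ k I Δ → At (Γ ▷ C) (binders C + k) I Δ
At-▷ (sortE h)   a = a
At-▷ (lamE W C)  {k = k} a = At-reindex (At-▷ C (there a)) (+-suc (binders C) k)
At-▷ (abbrE V C) {k = k} a = At-reindex (At-▷ C (there a)) (+-suc (binders C) k)
At-▷ (applE V C) a = At-▷ C a
At-▷ (castE W C) a = At-▷ C a

∷-▷-At : ∀ C₂ → At ((I ∷ Γ) ▷ C₂) (binders C₂) I Γ
∷-▷-At C₂ = At-reindex (At-▷ C₂ here) (+-identityʳ (binders C₂))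

graft-At : ∀ {C₁ C₂} I → E ≡ graft C₁ (itemEnv I C₂) → At (ctx E) (binders C₂) I (ctx C₁)
graft-At {C₁ = C₁} {C₂} (decl W) refl =
  subst (λ Γ → At Γ (binders C₂) _ (ctx C₁)) (sym (▷-graft C₁ (lamE W C₂) [])) (∷-▷-At {Γ = ctx C₁} C₂)
graft-At {C₁ = C₁} {C₂} (defn V) refl =
  subst (λ Γ → At Γ (binders C₂) _ (ctx C₁)) (sym (▷-graft C₁ (abbrE V C₂) [])) (∷-▷-At {Γ = ctx C₁} C₂)

record SplitAt (E : Env) (Γ : Ctx) (k : ℕ) (I : Item) (Δ : Ctx) : Set where
  constructor split
  field
    outer inner : Env
    E≡       : E ≡ graft outer (itemEnv I inner)
    binders≡ : binders inner ≡ k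
    ctx≡     : Γ ▷ outer ≡ Δ

At-▷⁻¹ : ∀ E Γ → At (Γ ▷ E) k I Δ → SplitAt E Γ k I Δ ⊎ ∃ λ k′ → k ≡ binders E + k′ × At Γ k′ I Δ
At-▷⁻¹ (sortE h) Γ a = inj₂ (_ , refl , a)
At-▷⁻¹ (lamE W C) Γ a with At-▷⁻¹ C (decl W ∷ Γ) a
... | inj₁ (split C₁ C₂ e n t)       = inj₁ (split (lamE W C₁) C₂ (cong (lamE W) e) n t)
... | inj₂ (zero , e , here)         = inj₁ (split (sortE 0) C refl (sym (trans e (+-identityʳ (binders C)))) refl)
... | inj₂ (suc k′ , e , there a′)   = inj₂ (k′ , trans e (+-suc (binders C) k′) , a′)
At-▷⁻¹ (abbrE V C) Γ a with At-▷⁻¹ C (defn V ∷ Γ) a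
... | inj₁ (split C₁ C₂ e n t)       = inj₁ (split (abbrE V C₁) C₂ (cong (abbrE V) e) n t)
... | inj₂ (zero , e , here)         = inj₁ (split (sortE 0) C refl (sym (trans e (+-identityʳ (binders C)))) refl)
... | inj₂ (suc k′ , e , there a′)   = inj₂ (k′ , trans e (+-suc (binders C) k′) , a′)
At-▷⁻¹ (applE V C) Γ a with At-▷⁻¹ C Γ a
... | inj₁ (split C₁ C₂ e n t) = inj₁ (split (applE V C₁) C₂ (cong (applE V) e) n t)
... | inj₂ x                   = inj₂ x
At-▷⁻¹ (castE W C) Γ a with At-▷⁻¹ C Γ a
... | inj₁ (split C₁ C₂ e n t) = inj₁ (split (castE W C₁) C₂ (cong (castE W) e) n t)
... | inj₂ x                   = inj₂ x

At-graft : At (ctx E) k I Δ → SplitAt E [] k I Δ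
At-graft {E} a with At-▷⁻¹ E [] a
... | inj₁ s = s

lift-[] : ∀ V T → (lift 0 1 T) [ V ] ≡ T
lift-[] V T = trans (cong (_[ V ]) (lift≡wk T)) (wk-[] V T)

→0⇒≈ : A →0 B → A ≈ B
→0⇒≈ r-refl       = ε
→0⇒≈ (r-lam r s)  = ≈-cong₂ lam  ⇛lam  (→0⇒≈ r) (→0⇒≈ s)
→0⇒≈ (r-abbr r s) = ≈-cong₂ abbr ⇛abbr (→0⇒≈ r) (→0⇒≈ s)
→0⇒≈ (r-appl r s) = ≈-cong₂ appl ⇛appl (→0⇒≈ r) (→0⇒≈ s)
→0⇒≈ (r-cast r s) = ≈-cong₂ cast ⇛cast (→0⇒≈ r) (→0⇒≈ s)
→0⇒≈ (r-β r s) =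
  ≈-cong₂ appl ⇛appl (→0⇒≈ r) (≈-cong₂ lam ⇛lam ε (→0⇒≈ s)) ◅◅ ⇛⇒≈ (⇛β (⇛-refl _) (⇛-refl _))
→0⇒≈ (r-δ {V₂ = V₂} {T₂ = T₂} {T = T} r s (_ , _ , rep)) =
  ≈-cong₂ abbr ⇛abbr (→0⇒≈ r) (→0⇒≈ s) ◅◅ ⇛⇒≈ (⇛let (⇛-refl V₂) (⇛-refl T₂))
  ◅◅ ≡⇒≈ (sub-cong-Rep rep (V₂ ∷ₛ var) (lift-[] V₂ V₂)) ◅◅ ≈-sym (⇛⇒≈ (⇛let (⇛-refl V₂) (⇛-refl T)))
→0⇒≈ (r-ζ {V = V} {T₂ = T₂} s _ refl) =
  ≈-cong₂ abbr ⇛abbr ε (→0⇒≈ s) ◅◅ ⇛⇒≈ (⇛-≡ (⇛let (⇛-refl V) (⇛-refl _)) (lift-[] V T₂))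
→0⇒≈ (r-τ s) = ≈-cong₂ cast ⇛cast ε (→0⇒≈ s) ◅◅ ⇛⇒≈ (⇛τ (⇛-refl _))
→0⇒≈ (r-υ {V₃ = V₃} r s t) =
  ≈-cong₂ appl ⇛appl (→0⇒≈ r) (≈-cong₂ abbr ⇛abbr (→0⇒≈ s) (→0⇒≈ t))
  ◅◅ ⇛⇒≈ (⇛-≡ (⇛υ (⇛-refl _) (⇛-refl _) (⇛-refl _)) (cong (λ X → abbr _ (appl X _)) (sym (lift≡wk V₃))))

⇔⇒≅ : E ⊢ A ⇔ B → ctx E ⊩ A ≅ B
⇔⇒≅ {E} (conv-step (red-0 r)) = via-unfold (≈-sub (unfold (ctx E)) (→0⇒≈ r))
⇔⇒≅ {E} (conv-step (red-δ C₁ C₂ V e r (_ , _ , rep))) =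
  via-unfold (≈-sub (unfold (ctx E)) (→0⇒≈ r) ◅◅ ≡⇒≈ (sub-cong-Rep rep (unfold (ctx E)) unfold-V))
  where
  a = graft-At (defn V) e
  unfold-V : sub (unfold (ctx E)) (lift 0 (suc (binders C₂)) V) ≡ unfold (ctx E) (binders C₂)
  unfold-V = trans (cong (sub (unfold (ctx E))) (lift≡wkⁿ _ V)) (trans (sub-unfold-wkⁿ (At⇒Drop a) V) (sym (unfold-defn a)))
⇔⇒≅ (conv-sym p)     = ≅-sym (⇔⇒≅ p)
⇔⇒≅ (conv-trans p q) = ≅-trans (⇔⇒≅ p) (⇔⇒≅ q)

infix 4 _→0*_

_→0*_ : Term → Term → Set
_→0*_ = Star _→0_

→0*-cong₂ : (f : Term → Term → Term) → (∀ {A A′ B B′} → A →0 A′ → B →0 B′ → f A B →0 f A′ B′) →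
            A →0* A′ → B →0* B′ → f A B →0* f A′ B′
→0*-cong₂ f f→0 p q = Star.gmap (λ X → f X _) (λ r → f→0 r r-refl) p ◅◅ Star.gmap (f _) (f→0 r-refl) q

abbr-Rep-→0* : ∀ b → Rep b 0 (lift 0 1 V) T T′ → abbr V T →0* abbr V T′
abbr-Rep-→0* {V = V} true rep = r-δ r-refl r-refl (∉FV-lift 0 V , Rep-true⇒∈FV rep refl , rep) ◅ ε
abbr-Rep-→0* false rep        = subst (λ X → abbr _ _ →0* abbr _ X) (Rep-false⇒≡ rep refl) ε

abbr-→0*-[] : ∀ V T → abbr V T →0* T [ V ]
abbr-→0*-[] V T
  with b , rep ← Rep-unfoldHead 0 V T
  = abbr-Rep-→0* b rep ◅◅ (r-ζ r-refl (∉FV-wk (T [ V ]) ∘ subst (0 ∈FV_) (unfoldHead-[] V T))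
                                      (trans (unfoldHead-[] V T) (sym (lift≡wk (T [ V ])))) ◅ ε)

-- A ⇛let step is a δ-step, which replaces every occurrence at once, followed by a ζ-step.
⇛⇒→0* : A ⇛ B → A →0* B
⇛⇒→0* ⇛sort       = ε
⇛⇒→0* ⇛var        = ε
⇛⇒→0* (⇛lam r s)  = →0*-cong₂ lam  r-lam  (⇛⇒→0* r) (⇛⇒→0* s)
⇛⇒→0* (⇛abbr r s) = →0*-cong₂ abbr r-abbr (⇛⇒→0* r) (⇛⇒→0* s)
⇛⇒→0* (⇛appl r s) = →0*-cong₂ appl r-appl (⇛⇒→0* r) (⇛⇒→0* s)
⇛⇒→0* (⇛cast r s) = →0*-cong₂ cast r-cast (⇛⇒→0* r) (⇛⇒→0* s)
⇛⇒→0* (⇛β r s)    = →0*-cong₂ appl r-appl (⇛⇒→0* r) (→0*-cong₂ lam r-lam ε (⇛⇒→0* s)) ◅◅ (r-β r-refl r-refl ◅ ε)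
⇛⇒→0* (⇛let r s)  = →0*-cong₂ abbr r-abbr (⇛⇒→0* r) (⇛⇒→0* s) ◅◅ abbr-→0*-[] _ _
⇛⇒→0* (⇛τ s)      = →0*-cong₂ cast r-cast ε (⇛⇒→0* s) ◅◅ (r-τ r-refl ◅ ε)
⇛⇒→0* (⇛υ {V₃ = V₃} {V₄} {T₂ = T₂} r s t) =
  →0*-cong₂ appl r-appl (⇛⇒→0* r) (→0*-cong₂ abbr r-abbr (⇛⇒→0* s) (⇛⇒→0* t))
  ◅◅ (subst (λ X → appl V₃ (abbr V₄ T₂) →0 abbr V₄ (appl X T₂)) (lift≡wk V₃) (r-υ r-refl r-refl r-refl) ◅ ε)

⇔-refl : E ⊢ A ⇔ A
⇔-refl = conv-step (red-0 r-refl)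

≡⇒⇔ : A ≡ B → E ⊢ A ⇔ B
≡⇒⇔ refl = ⇔-refl

→0*⇒⇔ : A →0* B → E ⊢ A ⇔ B
→0*⇒⇔ ε        = ⇔-refl
→0*⇒⇔ (r ◅ rs) = conv-trans (conv-step (red-0 r)) (→0*⇒⇔ rs)

≈⇒⇔ : A ≈ B → E ⊢ A ⇔ B
≈⇒⇔ ε           = ⇔-refl
≈⇒⇔ (fwd r ◅ p) = conv-trans (→0*⇒⇔ (⇛⇒→0* r)) (≈⇒⇔ p)
≈⇒⇔ (bwd r ◅ p) = conv-trans (conv-sym (→0*⇒⇔ (⇛⇒→0* r))) (≈⇒⇔ p)

unfoldHead-⇔ : At (ctx E) d (defn V) Δ → ∀ X → E ⊢ X ⇔ sub (⇑ⁿ d (unfoldHead V)) X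
unfoldHead-⇔ {d = d} {V} a X with Rep-unfoldHead d V X | At-graft a
... | true  , rep | split C₁ C₂ e refl _ =
  conv-step (red-δ C₁ C₂ V e r-refl (∉FV-lift _ V , Rep-true⇒∈FV rep refl , rep))
... | false , rep | _                    = ≡⇒⇔ (Rep-false⇒≡ rep refl)

-- The definitions of Γ₁ are unfolded one at a time, each by a single δ-step.
unfold-⇔ : ∀ Γ₁ X → Drop d (ctx E) Γ₁ → E ⊢ X ⇔ sub (⇑ⁿ d (unfold Γ₁)) X
unfold-⇔ {d} [] X p = ≡⇒⇔ (sym (sub-id (⇑ⁿ-id d) X))
unfold-⇔ {d} (decl W ∷ Γ₁) X p =
  conv-trans (unfold-⇔ Γ₁ X (Drop-∷ p)) (≡⇒⇔ (sub-cong (λ j → sym (⇑ⁿ-⇑ d (unfold Γ₁) j)) X))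
unfold-⇔ {d} (defn V ∷ Γ₁) X p =
  conv-trans (unfoldHead-⇔ (Drop⇒At p) X) (conv-trans (unfold-⇔ Γ₁ (sub unfoldHeadᵈ X) (Drop-∷ p)) (≡⇒⇔ regroup))
  where
  unfoldHeadᵈ = ⇑ⁿ d (unfoldHead V)
  unfold-defn-∷ : unfold (defn V ∷ Γ₁) ≗ sub (⇑ (unfold Γ₁)) ∘ unfoldHead V
  unfold-defn-∷ zero    = sym (sub-⇑-wk (unfold Γ₁) V)
  unfold-defn-∷ (suc j) = refl
  regroup : sub (⇑ⁿ (suc d) (unfold Γ₁)) (sub unfoldHeadᵈ X) ≡ sub (⇑ⁿ d (unfold (defn V ∷ Γ₁))) X
  regroup = begin
    sub (⇑ⁿ (suc d) (unfold Γ₁)) (sub unfoldHeadᵈ X)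
      ≡⟨ sub-sub _ unfoldHeadᵈ X ⟩
    sub (sub (⇑ⁿ (suc d) (unfold Γ₁)) ∘ unfoldHeadᵈ) X
      ≡⟨ sub-cong (λ j → sub-cong (⇑ⁿ-⇑ d (unfold Γ₁)) (unfoldHeadᵈ j)) X ⟨
    sub (sub (⇑ⁿ d (⇑ (unfold Γ₁))) ∘ unfoldHeadᵈ) X
      ≡⟨ sub-cong (⇑ⁿ-sub-∘ d (⇑ (unfold Γ₁)) (unfoldHead V)) X ⟨
    sub (⇑ⁿ d (sub (⇑ (unfold Γ₁)) ∘ unfoldHead V)) X
      ≡⟨ sub-cong (⇑ⁿ-cong d unfold-defn-∷) X ⟨
    sub (⇑ⁿ d (unfold (defn V ∷ Γ₁))) X
      ∎
    where open ≡-Reasoning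

≅⇒⇔ : ctx E ⊩ A ≅ B → E ⊢ A ⇔ B
≅⇒⇔ {E} {A} {B} (via-unfold p) =
  conv-trans (unfold-⇔ (ctx E) A stop) (conv-trans (≈⇒⇔ p) (conv-sym (unfold-⇔ (ctx E) B stop)))

module TypeAssignment (g : ℕ → ℕ) where

  infix 4 _⊩_∶_

  data _⊩_∶_ : Ctx → Term → Term → Set where
    ⊩sort : ∀ {h} → Γ ⊩ sort h ∶ sort (g h)
    ⊩def  : At Γ k (defn V) Δ → Δ ⊩ V ∶ W → Γ ⊩ var k ∶ wkⁿ (suc k) W
    ⊩decl : At Γ k (decl W) Δ → Δ ⊩ W ∶ V → Γ ⊩ var k ∶ wkⁿ (suc k) W
    ⊩abbr : Γ ⊩ V ∶ W → defn V ∷ Γ ⊩ T ∶ U → Γ ⊩ abbr V T ∶ abbr V U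
    ⊩abst : Γ ⊩ W ∶ V → decl W ∷ Γ ⊩ T ∶ U → Γ ⊩ lam W T ∶ lam W U
    ⊩appl : Γ ⊩ V ∶ W → Γ ⊩ T ∶ lam W U → Γ ⊩ appl V T ∶ appl V (lam W U)
    ⊩cast : Γ ⊩ T ∶ W → Γ ⊩ W ∶ V → Γ ⊩ cast W T ∶ cast V W
    ⊩conv : Γ ⊩ U₂ ∶ W → Γ ⊩ T ∶ U₁ → Γ ⊩ U₁ ≅ U₂ → Γ ⊩ T ∶ U₂

  Typable : Ctx → Term → Set
  Typable Γ U = ∃ λ W → Γ ⊩ U ∶ W

  ⊩-conv : Typable Γ U₂ → Γ ⊩ T ∶ U₁ → Γ ⊩ U₁ ≅ U₂ → Γ ⊩ T ∶ U₂
  ⊩-conv (_ , D) D′ c = ⊩conv D D′ c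

  ⊩-≡ : Γ ⊩ T ∶ U → T ≡ A → U ≡ B → Γ ⊩ A ∶ B
  ⊩-≡ D refl refl = D

  ⊩-weaken : Ins d Γ Γ′ → Γ ⊩ T ∶ U → Γ′ ⊩ ren (insʳ d) T ∶ ren (insʳ d) U
  ⊩-weaken p ⊩sort = ⊩sort
  ⊩-weaken p (⊩def {W = W} a D) with At-Ins p a
  ... | shallower q a′ e f = ⊩-≡ (⊩def a′ (⊩-weaken q D)) (cong var (sym e)) (sym (f W))
  ... | deeper a′ e f      = ⊩-≡ (⊩def a′ D) (cong var (sym e)) (sym (f W))
  ⊩-weaken p (⊩decl {W = W} a D) with At-Ins p a
  ... | shallower q a′ e f = ⊩-≡ (⊩decl a′ (⊩-weaken q D)) (cong var (sym e)) (sym (f W))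
  ... | deeper a′ e f      = ⊩-≡ (⊩decl a′ D) (cong var (sym e)) (sym (f W))
  ⊩-weaken p (⊩abbr D E)   = ⊩abbr (⊩-weaken p D) (⊩-weaken (ins-there p) E)
  ⊩-weaken p (⊩abst D E)   = ⊩abst (⊩-weaken p D) (⊩-weaken (ins-there p) E)
  ⊩-weaken p (⊩appl D E)   = ⊩appl (⊩-weaken p D) (⊩-weaken p E)
  ⊩-weaken p (⊩cast D E)   = ⊩cast (⊩-weaken p D) (⊩-weaken p E)
  ⊩-weaken p (⊩conv D E c) = ⊩conv (⊩-weaken p D) (⊩-weaken p E) (≅-Ins p c)

  ⊩-wk : Γ ⊩ T ∶ U → I ∷ Γ ⊩ wk T ∶ wk U
  ⊩-wk = ⊩-weaken ins-here

  ⊩-wkⁿ : Drop n Γ Δ → Δ ⊩ T ∶ U → Γ ⊩ wkⁿ n T ∶ wkⁿ n U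
  ⊩-wkⁿ stop    D = D
  ⊩-wkⁿ (pop p) D = ⊩-wk (⊩-wkⁿ p D)

  ⊩sort⁻¹ : Γ ⊩ sort k ∶ X → Γ ⊩ sort (g k) ≅ X
  ⊩sort⁻¹ ⊩sort         = ≅-refl
  ⊩sort⁻¹ (⊩conv _ D c) = ≅-trans (⊩sort⁻¹ D) c

  data VarInv (Γ : Ctx) (k : ℕ) (X : Term) : Set where
    defn-inv : ∀ {V Δ W} → At Γ k (defn V) Δ → Δ ⊩ V ∶ W → Γ ⊩ wkⁿ (suc k) W ≅ X → VarInv Γ k X
    decl-inv : ∀ {W Δ V} → At Γ k (decl W) Δ → Δ ⊩ W ∶ V → Γ ⊩ wkⁿ (suc k) W ≅ X → VarInv Γ k X

  ⊩var⁻¹ : Γ ⊩ var k ∶ X → VarInv Γ k X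
  ⊩var⁻¹ (⊩def a D)  = defn-inv a D ≅-refl
  ⊩var⁻¹ (⊩decl a D) = decl-inv a D ≅-refl
  ⊩var⁻¹ (⊩conv _ D c) with ⊩var⁻¹ D
  ... | defn-inv a E c′ = defn-inv a E (≅-trans c′ c)
  ... | decl-inv a E c′ = decl-inv a E (≅-trans c′ c)

  record AbbrInv (Γ : Ctx) (V T X : Term) : Set where
    constructor abbr-inv
    field
      {V-type T-type} : Term
      V-typed : Γ ⊩ V ∶ V-type
      T-typed : defn V ∷ Γ ⊩ T ∶ T-type
      type≅   : Γ ⊩ abbr V T-type ≅ X

  ⊩abbr⁻¹ : Γ ⊩ abbr V T ∶ X → AbbrInv Γ V T X
  ⊩abbr⁻¹ (⊩abbr D E)   = abbr-inv D E ≅-refl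
  ⊩abbr⁻¹ (⊩conv _ D c) with abbr-inv E₁ E₂ c′ ← ⊩abbr⁻¹ D = abbr-inv E₁ E₂ (≅-trans c′ c)

  record AbstInv (Γ : Ctx) (W T X : Term) : Set where
    constructor abst-inv
    field
      {W-type T-type} : Term
      W-typed : Γ ⊩ W ∶ W-type
      T-typed : decl W ∷ Γ ⊩ T ∶ T-type
      type≅   : Γ ⊩ lam W T-type ≅ X

  ⊩abst⁻¹ : Γ ⊩ lam W T ∶ X → AbstInv Γ W T X
  ⊩abst⁻¹ (⊩abst D E)   = abst-inv D E ≅-refl
  ⊩abst⁻¹ (⊩conv _ D c) with abst-inv E₁ E₂ c′ ← ⊩abst⁻¹ D = abst-inv E₁ E₂ (≅-trans c′ c)

  record ApplInv (Γ : Ctx) (V T X : Term) : Set where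
    constructor appl-inv
    field
      {V-type T-codomain} : Term
      V-typed : Γ ⊩ V ∶ V-type
      T-typed : Γ ⊩ T ∶ lam V-type T-codomain
      type≅   : Γ ⊩ appl V (lam V-type T-codomain) ≅ X

  ⊩appl⁻¹ : Γ ⊩ appl V T ∶ X → ApplInv Γ V T X
  ⊩appl⁻¹ (⊩appl D E)   = appl-inv D E ≅-refl
  ⊩appl⁻¹ (⊩conv _ D c) with appl-inv E₁ E₂ c′ ← ⊩appl⁻¹ D = appl-inv E₁ E₂ (≅-trans c′ c)

  record CastInv (Γ : Ctx) (W T X : Term) : Set where
    constructor cast-inv
    field
      {W-type} : Term
      T-typed : Γ ⊩ T ∶ W
      W-typed : Γ ⊩ W ∶ W-type
      type≅   : Γ ⊩ cast W-type W ≅ X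

  ⊩cast⁻¹ : Γ ⊩ cast W T ∶ X → CastInv Γ W T X
  ⊩cast⁻¹ (⊩cast D E)   = cast-inv D E ≅-refl
  ⊩cast⁻¹ (⊩conv _ D c) with cast-inv E₁ E₂ c′ ← ⊩cast⁻¹ D = cast-inv E₁ E₂ (≅-trans c′ c)

  type-typable : Γ ⊩ T ∶ U → Typable Γ U
  type-typable ⊩sort = _ , ⊩sort
  type-typable (⊩def a D)  = _ , ⊩-wkⁿ (At⇒Drop a) (proj₂ (type-typable D))
  type-typable (⊩decl a D) = _ , ⊩-wkⁿ (At⇒Drop a) D
  type-typable (⊩abbr D E) = _ , ⊩abbr D (proj₂ (type-typable E))
  type-typable (⊩abst D E) = _ , ⊩abst D (proj₂ (type-typable E))
  type-typable (⊩appl D E) with abst-inv W-typed U-typed _ ← ⊩abst⁻¹ (proj₂ (type-typable E))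
    = _ , ⊩appl D (⊩abst W-typed U-typed)
  type-typable (⊩cast D E) = _ , ⊩cast E (proj₂ (type-typable E))
  type-typable (⊩conv D E c) = _ , D

  type-unique : Γ ⊩ T ∶ U₁ → Γ ⊩ T ∶ U₂ → Γ ⊩ U₁ ≅ U₂
  type-unique ⊩sort E = ⊩sort⁻¹ E
  type-unique (⊩def a D) E with ⊩var⁻¹ E
  ... | defn-inv a′ D′ c with refl , refl ← At-functional a a′ = ≅-trans (≅-wkⁿ (At⇒Drop a) (type-unique D D′)) c
  ... | decl-inv a′ _ _ with () ← At-functional a a′
  type-unique (⊩decl a D) E with ⊩var⁻¹ E
  ... | decl-inv a′ _ c with refl , refl ← At-functional a a′ = c
  ... | defn-inv a′ _ _ with () ← At-functional a a′
  type-unique (⊩abbr D D′) E with abbr-inv _ E′ c ← ⊩abbr⁻¹ E = ≅-trans (≅-abbrʳ (type-unique D′ E′)) c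
  type-unique (⊩abst D D′) E with abst-inv _ E′ c ← ⊩abst⁻¹ E = ≅-trans (≅-lam ≅-refl (type-unique D′ E′)) c
  type-unique (⊩appl D D′) E with appl-inv _ E′ c ← ⊩appl⁻¹ E = ≅-trans (≅-appl ≅-refl (type-unique D′ E′)) c
  type-unique (⊩cast D D′) E with cast-inv _ E′ c ← ⊩cast⁻¹ E = ≅-trans (≅-cast (type-unique D′ E′) ≅-refl) c
  type-unique (⊩conv _ D c) E = ≅-trans (≅-sym c) (type-unique D E)

  ItemType : Ctx → Item → Term → Set
  ItemType Γ₁ (defn V)  W = Γ₁ ⊩ V ∶ W
  ItemType Γ₁ (decl W′) W = W′ ≡ W × Typable Γ₁ W

  module _ {I I′ Γ₁}
    (ref : Refines (I ∷ Γ₁) (I′ ∷ Γ₁))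
    (retype : ∀ {d Γ′ W} → At Γ′ d I′ Γ₁ → ItemType Γ₁ I W → Γ′ ⊩ var d ∶ wkⁿ (suc d) W) where

    ⊩-replace : Replace I I′ Γ₁ d Γ Γ′ → Γ ⊩ T ∶ U → Γ′ ⊩ T ∶ U
    ⊩-replace p ⊩sort = ⊩sort
    ⊩-replace p (⊩def a D) with At-Replace p a
    ... | shallower a′ q = ⊩def a′ (⊩-replace q D)
    ... | replaced       = retype (Replace⇒At p) D
    ... | deeper a′      = ⊩def a′ D
    ⊩-replace p (⊩decl a D) with At-Replace p a
    ... | shallower a′ q = ⊩decl a′ (⊩-replace q D)
    ... | replaced       = retype (Replace⇒At p) (refl , _ , D)
    ... | deeper a′      = ⊩decl a′ D
    ⊩-replace p (⊩abbr D E)   = ⊩abbr (⊩-replace p D) (⊩-replace (replace-there p) E)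
    ⊩-replace p (⊩abst D E)   = ⊩abst (⊩-replace p D) (⊩-replace (replace-there p) E)
    ⊩-replace p (⊩appl D E)   = ⊩appl (⊩-replace p D) (⊩-replace p E)
    ⊩-replace p (⊩cast D E)   = ⊩cast (⊩-replace p D) (⊩-replace p E)
    ⊩-replace p (⊩conv D E c) = ⊩conv (⊩-replace p D) (⊩-replace p E) (≅-Refines (Refines-Replace ref p) c)

  ⊩-replace-decl : Γ₁ ⊩ W′ ∶ A → Γ₁ ⊩ W′ ≅ W → decl W ∷ Γ₁ ⊩ T ∶ U → decl W′ ∷ Γ₁ ⊩ T ∶ U
  ⊩-replace-decl {Γ₁} {W′} {W = W} DW′ c = ⊩-replace (⇛ₛ⇒Refines (⇛ₛ-refl _)) retype replace-here
    where
    retype : ∀ {d Γ′ X} → At Γ′ d (decl W′) Γ₁ → ItemType Γ₁ (decl W) X → Γ′ ⊩ var d ∶ wkⁿ (suc d) X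
    retype a (refl , _ , DW) = ⊩conv (⊩-wkⁿ (At⇒Drop a) DW) (⊩decl a DW′) (≅-wkⁿ (At⇒Drop a) c)

  ⊩-replace-defn : sub (unfold Γ₁) V ⇛ sub (unfold Γ₁) V′ → (∀ {W} → Γ₁ ⊩ V ∶ W → Γ₁ ⊩ V′ ∶ W) →
                   defn V ∷ Γ₁ ⊩ T ∶ U → defn V′ ∷ Γ₁ ⊩ T ∶ U
  ⊩-replace-defn {Γ₁} {V} {V′} r inherit = ⊩-replace (⇛ₛ⇒Refines unfold-⇛) (λ a D → ⊩def a (inherit D)) replace-here
    where
    unfold-⇛ : unfold (defn V ∷ Γ₁) ⇛ₛ unfold (defn V′ ∷ Γ₁)
    unfold-⇛ zero    = ⇛-ren suc r
    unfold-⇛ (suc j) = ⇛-refl _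

  ⊩-decl→defn : Γ₁ ⊩ V ∶ W → decl W ∷ Γ₁ ⊩ T ∶ U → defn V ∷ Γ₁ ⊩ T ∶ U
  ⊩-decl→defn {Γ₁} {V} {W} DV = ⊩-replace (refines unfold-⇛) retype replace-here
    where
    defineHead : Sub
    defineHead = wk (sub (unfold Γ₁) V) ∷ₛ var ∘ suc
    unfold-⇛ : sub defineHead ∘ unfold (decl W ∷ Γ₁) ⇛ₛ unfold (defn V ∷ Γ₁)
    unfold-⇛ zero    = ⇛-refl _
    unfold-⇛ (suc j) = ≡-⇛ (trans (sub-ren defineHead suc (unfold Γ₁ j)) (sym (ren≡sub suc (unfold Γ₁ j)))) (⇛-refl _)
    retype : ∀ {d Γ′ X} → At Γ′ d (defn V) Γ₁ → ItemType Γ₁ (decl W) X → Γ′ ⊩ var d ∶ wkⁿ (suc d) X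
    retype a (refl , _) = ⊩def a DV

  ⊩-inline : Inline V Γ₁ d Γ Γ′ → Γ ⊩ T ∶ U → Γ′ ⊩ sub (substAt d V) T ∶ sub (substAt d V) U
  ⊩-inline p ⊩sort = ⊩sort
  ⊩-inline p (⊩def {W = W} a D) with At-Inline p a
  ... | shallower q a′ e f = ⊩-≡ (⊩def a′ (⊩-inline q D)) (sym e) (sym (f W))
  ... | inlined q e f      = ⊩-≡ (⊩-wkⁿ q D) (sym e) (sym (f W))
  ... | deeper a′ e f      = ⊩-≡ (⊩def a′ D) (sym e) (sym (f W))
  ⊩-inline p (⊩decl {W = W} a D) with At-Inline p a
  ... | shallower q a′ e f = ⊩-≡ (⊩decl a′ (⊩-inline q D)) (sym e) (sym (f W))
  ... | deeper a′ e f      = ⊩-≡ (⊩decl a′ D) (sym e) (sym (f W))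
  ⊩-inline p (⊩abbr D E)   = ⊩abbr (⊩-inline p D) (⊩-inline (inline-there p) E)
  ⊩-inline p (⊩abst D E)   = ⊩abst (⊩-inline p D) (⊩-inline (inline-there p) E)
  ⊩-inline p (⊩appl D E)   = ⊩appl (⊩-inline p D) (⊩-inline p E)
  ⊩-inline p (⊩cast D E)   = ⊩cast (⊩-inline p D) (⊩-inline p E)
  ⊩-inline p (⊩conv D E c) = ⊩conv (⊩-inline p D) (⊩-inline p E) (≅-Inline p c)

  ⊩-[] : defn V ∷ Γ ⊩ T ∶ U → Γ ⊩ T [ V ] ∶ U [ V ]
  ⊩-[] = ⊩-inline inline-here

  ⊩-retype : Γ ⊩ T ∶ U → Γ ⊩ T′ ∶ U′ → Γ ⊩ U′ ≅ U → Γ ⊩ T′ ∶ U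
  ⊩-retype D D′ c = ⊩-conv (type-typable D) D′ c

  record BetaInv (Γ : Ctx) (V W T X : Term) : Set where
    constructor β-inv
    field
      {T-type} : Term
      V-typed  : Γ ⊩ V ∶ W
      T-typed  : decl W ∷ Γ ⊩ T ∶ T-type
      type≅    : Γ ⊩ appl V (lam W T-type) ≅ X

  ⊩β-redex⁻¹ : Γ ⊩ appl V (lam W T) ∶ X → BetaInv Γ V W T X
  ⊩β-redex⁻¹ D
    with appl-inv DV DL c ← ⊩appl⁻¹ D
    with abst-inv DW DT c′ ← ⊩abst⁻¹ DL
    = β-inv (⊩-conv (_ , DW) DV (≅-sym (lam-≅-domain c′))) DT (≅-trans (≅-appl ≅-refl c′) c)

  record UpsilonInv (Γ : Ctx) (V₁ V₂ T X : Term) : Set where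
    constructor υ-inv
    field
      {V₁-type V₂-type codomain} : Term
      V₁-typed : Γ ⊩ V₁ ∶ V₁-type
      V₂-typed : Γ ⊩ V₂ ∶ V₂-type
      T-typed  : defn V₂ ∷ Γ ⊩ T ∶ wk (lam V₁-type codomain)
      type≅    : Γ ⊩ appl V₁ (lam V₁-type codomain) ≅ X

  ⊩υ-redex⁻¹ : Γ ⊩ appl V₁ (abbr V₂ T) ∶ X → UpsilonInv Γ V₁ V₂ T X
  ⊩υ-redex⁻¹ D
    with appl-inv DV₁ DA c ← ⊩appl⁻¹ D
    with abbr-inv DV₂ DT c′ ← ⊩abbr⁻¹ DA
    = υ-inv DV₁ DV₂ (⊩-conv (_ , ⊩-wk (proj₂ (type-typable DA))) DT (abbr-≅-body c′)) c

  subject-reduction : T ⇛ T′ → Γ ⊩ T ∶ U → Γ ⊩ T′ ∶ U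
  ⊩-defn-⇛ : V ⇛ V′ → defn V ∷ Γ ⊩ T ∶ U → defn V′ ∷ Γ ⊩ T ∶ U

  ⊩-defn-⇛ r = ⊩-replace-defn (⇛-sub (⇛ₛ-refl _) r) (subject-reduction r)

  subject-reduction ⇛sort D = D
  subject-reduction ⇛var  D = D
  subject-reduction (⇛lam r s) D with abst-inv DW DT c ← ⊩abst⁻¹ D =
    ⊩-retype D (⊩abst DW′ (⊩-replace-decl DW′ (⇚⇒≅ r) (subject-reduction s DT))) (≅-trans (≅-lam (⇚⇒≅ r) ≅-refl) c)
    where
    DW′ = subject-reduction r DW
  subject-reduction (⇛abbr r s) D with abbr-inv DV DT c ← ⊩abbr⁻¹ D =
    ⊩-retype D (⊩abbr (subject-reduction r DV) (⊩-defn-⇛ r (subject-reduction s DT))) (≅-trans (≅-abbrˡ (⇚⇒≅ r)) c)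
  subject-reduction (⇛appl r s) D with appl-inv DV DT c ← ⊩appl⁻¹ D =
    ⊩-retype D (⊩appl (subject-reduction r DV) (subject-reduction s DT)) (≅-trans (≅-appl (⇚⇒≅ r) ≅-refl) c)
  subject-reduction (⇛cast r s) D with cast-inv DT DW c ← ⊩cast⁻¹ D =
    ⊩-retype D (⊩cast (⊩conv DW′ (subject-reduction s DT) (⇛⇒≅ r)) DW′) (≅-trans (≅-cast ≅-refl (⇚⇒≅ r)) c)
    where
    DW′ = subject-reduction r DW
  subject-reduction (⇛β r s) D with β-inv {U} DV DT c ← ⊩β-redex⁻¹ D =
    ⊩-retype D (⊩abbr (subject-reduction r DV) (⊩-defn-⇛ r (subject-reduction s (⊩-decl→defn DV DT))))
      (≅-trans (≅-abbrˡ (⇚⇒≅ r)) (≅-trans (⇚⇒≅ (⇛β (⇛-refl _) (⇛-refl U))) c))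
  subject-reduction (⇛let r s) D with abbr-inv {T-type = U} _ DT c ← ⊩abbr⁻¹ D =
    ⊩-retype D (⊩-[] (⊩-defn-⇛ r (subject-reduction s DT)))
      (≅-trans (⇚⇒≅ (⇛let (⇛-refl _) (⇛-refl U))) (≅-trans (≅-abbrˡ (⇚⇒≅ r)) c))
  subject-reduction (⇛τ s) D with cast-inv DT _ c ← ⊩cast⁻¹ D =
    ⊩-retype D (subject-reduction s DT) (≅-trans (⇚⇒≅ (⇛τ (⇛-refl _))) c)
  subject-reduction (⇛υ {V₃ = V₃} {V₄} r s t) D with υ-inv {W} {_} {U} DV₁ DV₂ DT c ← ⊩υ-redex⁻¹ D =
    ⊩-retype D (⊩abbr (subject-reduction s DV₂) (⊩appl (⊩-wk (subject-reduction r DV₁)) (⊩-defn-⇛ s (subject-reduction t DT))))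
      (≅-trans (⇛⇒≅ (⇛-≡ (⇛let (⇛-refl V₄) (⇛-refl _)) (wk-[] V₄ (appl V₃ (lam W U)))))
               (≅-trans (≅-appl (⇚⇒≅ r) ≅-refl) c))

  subject-reduction* : T ⇛* T′ → Γ ⊩ T ∶ U → Γ ⊩ T′ ∶ U
  subject-reduction* ε        D = D
  subject-reduction* (r ◅ rs) D = subject-reduction* rs (subject-reduction r D)

  -- ⇑ⁿ d (unfold Γ₁) unfolds the definitions of Γ lying below its first d items.
  ⊩-unfold : Drop d Γ Γ₁ → Γ ⊩ T ∶ U → Γ ⊩ sub (⇑ⁿ d (unfold Γ₁)) T ∶ U
  ⊩-unfold p ⊩sort = ⊩sort
  ⊩-unfold p (⊩def {k = k} a D) with ⇑ⁿ-unfold-var p k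
  ... | inj₁ e = ⊩-≡ (⊩def a D) (sym e) refl
  ... | inj₂ e = ⊩-≡ (⊩-wkⁿ (At⇒Drop a) (⊩-unfold stop D)) (sym (trans e (unfold-defn a))) refl
  ⊩-unfold p (⊩decl {k = k} a D) with ⇑ⁿ-unfold-var p k
  ... | inj₁ e = ⊩-≡ (⊩decl a D) (sym e) refl
  ... | inj₂ e = ⊩-≡ (⊩decl a D) (sym (trans e (unfold-decl a))) refl
  ⊩-unfold {d} {Γ} {Γ₁} p D@(⊩abbr {V = V} DV DT) =
    ⊩-retype D (⊩abbr DV′ (⊩-replace-defn (⇛-≡ (⇛-refl _) (sym same-unfolding)) inherit (⊩-unfold (pop p) DT)))
           (≅-abbrˡ (⇑ⁿ-unfold-≅ p V))
    where
    DV′ = ⊩-unfold p DV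
    same-unfolding : sub (unfold Γ) (sub (⇑ⁿ d (unfold Γ₁)) V) ≡ sub (unfold Γ) V
    same-unfolding = trans (sub-sub (unfold Γ) (⇑ⁿ d (unfold Γ₁)) V) (sub-cong (unfold-⇑ⁿ-unfold p) V)
    inherit : ∀ {W} → Γ ⊩ V ∶ W → Γ ⊩ sub (⇑ⁿ d (unfold Γ₁)) V ∶ W
    inherit E = ⊩-retype E DV′ (type-unique DV E)
  ⊩-unfold p D@(⊩abst {W = W} DW DT) =
    ⊩-retype D (⊩abst DW′ (⊩-replace-decl DW′ (⇑ⁿ-unfold-≅ p W) (⊩-unfold (pop p) DT)))
           (≅-lam (⇑ⁿ-unfold-≅ p W) ≅-refl)
    where
    DW′ = ⊩-unfold p DW
  ⊩-unfold p D@(⊩appl {V = V} DV DT) =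
    ⊩-retype D (⊩appl (⊩-unfold p DV) (⊩-unfold p DT)) (≅-appl (⇑ⁿ-unfold-≅ p V) ≅-refl)
  ⊩-unfold p D@(⊩cast {W = W} DT DW) =
    ⊩-retype D (⊩cast (⊩conv DW′ (⊩-unfold p DT) (≅-sym (⇑ⁿ-unfold-≅ p W))) DW′)
           (≅-cast ≅-refl (⇑ⁿ-unfold-≅ p W))
    where
    DW′ = ⊩-unfold p DW
  ⊩-unfold p (⊩conv E D c) = ⊩conv E (⊩-unfold p D) c

  ⊩-subject-conversion : Γ ⊩ U₁ ∶ T₁ → Γ ⊩ U₂ ∶ T₂ → Γ ⊩ U₁ ≅ U₂ → Γ ⊩ T₁ ≅ T₂
  ⊩-subject-conversion D₁ D₂ (via-unfold c) with _ , r₁ , r₂ ← church-rosser c =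
    type-unique (subject-reduction* r₁ (⊩-unfold stop D₁)) (subject-reduction* r₂ (⊩-unfold stop D₂))

  ⊩-ctx-≡ : ∀ {Γ Δ T U} → Γ ≡ Δ → Γ ⊩ T ∶ U → Δ ⊩ T ∶ U
  ⊩-ctx-≡ refl D = D

  ⊢⇒⊩ : E ⊢[ g ] T ∶ U → ctx E ⊩ T ∶ U
  ⊢⇒⊩ ty-sort = ⊩sort
  ⊢⇒⊩ (ty-def C₁ C₂ {V} {W} e D) = ⊩-≡ (⊩def (graft-At (defn V) e) (⊢⇒⊩ D)) refl (sym (lift≡wkⁿ _ W))
  ⊢⇒⊩ (ty-decl C₁ C₂ {W} e D)    = ⊩-≡ (⊩decl (graft-At (decl W) e) (⊢⇒⊩ D)) refl (sym (lift≡wkⁿ _ W))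
  ⊢⇒⊩ {E} (ty-abbr {V = V} D D′) = ⊩abbr (⊢⇒⊩ D) (⊩-ctx-≡ (ctx-∙δ E V) (⊢⇒⊩ D′))
  ⊢⇒⊩ {E} (ty-abst {W = W} D D′) = ⊩abst (⊢⇒⊩ D) (⊩-ctx-≡ (ctx-∙λ E W) (⊢⇒⊩ D′))
  ⊢⇒⊩ (ty-appl D D′)   = ⊩appl (⊢⇒⊩ D) (⊢⇒⊩ D′)
  ⊢⇒⊩ (ty-cast D D′)   = ⊩cast (⊢⇒⊩ D) (⊢⇒⊩ D′)
  ⊢⇒⊩ (ty-conv D D′ c) = ⊩conv (⊢⇒⊩ D) (⊢⇒⊩ D′) (⇔⇒≅ c)

  ⊩⇒⊢ : Γ ⊩ T ∶ U → ctx E ≡ Γ → E ⊢[ g ] T ∶ U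
  ⊩⇒⊢ ⊩sort _ = ty-sort
  ⊩⇒⊢ {E = E} (⊩def {W = W} a D) refl with split C₁ C₂ e refl Δ≡ ← At-graft a =
    subst (E ⊢[ g ] _ ∶_) (lift≡wkⁿ _ W) (ty-def C₁ C₂ e (⊩⇒⊢ D Δ≡))
  ⊩⇒⊢ {E = E} (⊩decl {W = W} a D) refl with split C₁ C₂ e refl Δ≡ ← At-graft a =
    subst (E ⊢[ g ] _ ∶_) (lift≡wkⁿ _ W) (ty-decl C₁ C₂ e (⊩⇒⊢ D Δ≡))
  ⊩⇒⊢ {E = E} (⊩abbr {V = V} D D′) refl = ty-abbr (⊩⇒⊢ D refl) (⊩⇒⊢ D′ (ctx-∙δ E V))
  ⊩⇒⊢ {E = E} (⊩abst {W = W} D D′) refl = ty-abst (⊩⇒⊢ D refl) (⊩⇒⊢ D′ (ctx-∙λ E W))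
  ⊩⇒⊢ (⊩appl D D′)   refl = ty-appl (⊩⇒⊢ D refl) (⊩⇒⊢ D′ refl)
  ⊩⇒⊢ (⊩cast D D′)   refl = ty-cast (⊩⇒⊢ D refl) (⊩⇒⊢ D′ refl)
  ⊩⇒⊢ (⊩conv D D′ c) refl = ty-conv (⊩⇒⊢ D refl) (⊩⇒⊢ D′ refl) (≅⇒⇔ c)

  ⊢-type-typable : E ⊢[ g ] T ∶ U → ∃ λ W → E ⊢[ g ] U ∶ W
  ⊢-type-typable D with W , DU ← type-typable (⊢⇒⊩ D) = W , ⊩⇒⊢ DU refl

  ⊢-subject-conversion : E ⊢[ g ] U₁ ∶ T₁ → E ⊢[ g ] U₂ ∶ T₂ → E ⊢ U₁ ⇔ U₂ → E ⊢ T₁ ⇔ T₂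
  ⊢-subject-conversion D₁ D₂ c = ≅⇒⇔ (⊩-subject-conversion (⊢⇒⊩ D₁) (⊢⇒⊩ D₂) (⇔⇒≅ c))

mainTheorem17 : (g : ℕ → ℕ) → (∀ h → h < g h) →
    (C : Env) (U₁ U₂ T₁ T₂ : Term) →
    C ⊢[ g ] U₁ ∶ T₁ → C ⊢[ g ] U₂ ∶ T₂ → C ⊢ U₁ ⇔ U₂ →
    (C ⊢ T₁ ⇔ T₂) × (C ⊢[ g ] U₁ ∶ T₂)
mainTheorem17 g _ C U₁ U₂ T₁ T₂ D₁ D₂ c = T₁⇔T₂ , ty-conv (proj₂ (⊢-type-typable D₂)) D₁ T₁⇔T₂
  where
  open TypeAssignment g
  T₁⇔T₂ : C ⊢ T₁ ⇔ T₂
  T₁⇔T₂ = ⊢-subject-conversion D₁ D₂ c
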